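{- The category $\mathbf{Pos}$ is monoidal with respect to the tensor product of $\mathrm{Int}(\mathbf{Rel})$: the tensor product of two positive maps is a positive map, and $\mathbf{Pos}$ with this tensor is a monoidal category.
   Context: $\mathbf{Rel}$ is the category of sets and binary relations; relational composition is written right to left, $R^*=\bigcup_{n\ge0}R^n$, and for $R\subseteq A\times B$, $X\subseteq A$, $Y\subseteq B$: $R[X]=\{y\mid\exists a\in X,(a,y)\in R\}$, $[Y]R=\{x\mid\exists b\in Y,(x,b)\in R\}$. $\mathrm{Int}(\mathbf{Rel})$: objects pairs of sets $(A^+,A^-)$; a morphism $R:(A^+,A^-)\to(B^+,B^-)$ is a relation $A^++B^-\to B^++A^-$ ($+$ = disjoint union), equivalently relations $R_{12}:A^+\to B^+$, $R_{11}:A^+\to A^-$, $R_{21}:B^-\to A^-$, $R_{22}:B^-\to B^+$; identity: $R_{12}=\mathrm{Id}$, $R_{21}=\mathrm{Id}$, $R_{11}=R_{22}=\emptyset$; composite with $S:(B^+,B^-)\to(C^+,C^-)$: $(SR)_{12}=S_{12}(R_{22}S_{11})^*R_{12}$, $(SR)_{22}=S_{22}\cup S_{12}R_{22}(S_{11}R_{22})^*S_{21}$, $(SR)_{11}=R_{11}\cup R_{21}S_{11}(R_{22}S_{11})^*R_{12}$, $(SR)_{21}=R_{21}(S_{11}R_{22})^*S_{21}$. Tensor: $(A^+,A^-)\otimes(C^+,C^-)=(A^++C^+,A^-+C^-)$, and for $R:(A^+,A^-)\to(B^+,B^-)$, $S:(C^+,C^-)\to(D^+,D^-)$, $(R\otimes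 S)_{ab}=R_{ab}+S_{ab}$ (disjoint sum of relations) for $ab\in\{11,12,21,22\}$. $\mathbf{Pos}$: objects $(A^+_{\mathrm{mp}(A^+)},A^-_{\mathrm{mp}(A^-)})$ with $(A^+,A^-)$ in $\mathrm{Int}(\mathbf{Rel})$ and subsets $\mathrm{mp}(A^\pm)\subseteq A^\pm$; tensor of objects $((A^++C^+)_{\mathrm{mp}(A^+)+\mathrm{mp}(C^+)},(A^-+C^-)_{\mathrm{mp}(A^-)+\mathrm{mp}(C^-)})$. Morphisms (positive maps) to $(B^+_{\mathrm{mp}(B^+)},B^-_{\mathrm{mp}(B^-)})$ are $\mathrm{Int}(\mathbf{Rel})$-morphisms $R$ with (1) $[\mathrm{mp}(B^+)]R_{12}=\mathrm{mp}(A^+)$, (2) $R_{21}[\mathrm{mp}(B^-)]=\mathrm{mp}(A^-)$, (3) $[\mathrm{mp}(B^+)]R_{22}=\emptyset=R_{22}[\mathrm{mp}(B^-)]$; identities and composition are those of $\mathrm{Int}(\mathbf{Rel})$. -}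

module Defs where

open import Level using (0ℓ)
open import Data.Empty using (⊥; ⊥-elim)
open import Data.Product using (Σ; ∃; _×_; _,_; proj₁; proj₂)
open import Data.Sum using (_⊎_; inj₁; inj₂; [_,_])
open import Relation.Nullary using (¬_)
open import Relation.Binary.PropositionalEquality using (_≡_)
open import Relation.Binary.Construct.Closure.ReflexiveTransitive using (Star)

Rel : Set → Set → Set₁
Rel A B = A → B → Set

-- relational composition, written right to left: (S ∙ R) = "S after R"
infixr 9 _∙_
_∙_ : {A B C : Set} → Rel B C → Rel A B → Rel A C
(S ∙ R) a c = ∃ λ b → R a b × S b c

infixr 6 _∪_
_∪_ : {A B : Set} → Rel A B → Rel A B → Rel A B
(R ∪ S) a b = R a b ⊎ S a b

∅R : {A B : Set} → Rel A B
∅R _ _ = ⊥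

IdR : {A : Set} → Rel A A
IdR a b = a ≡ b

graph : {A B : Set} → (A → B) → Rel A B
graph f a b = f a ≡ b

_* : {A : Set} → Rel A A → Rel A A
R * = Star R

_⊕_ : {A B C D : Set} → Rel A B → Rel C D → Rel (A ⊎ C) (B ⊎ D)
(R ⊕ S) (inj₁ a) (inj₁ b) = R a b
(R ⊕ S) (inj₂ c) (inj₂ d) = S c d
(R ⊕ S) (inj₁ _) (inj₂ _) = ⊥
(R ⊕ S) (inj₂ _) (inj₁ _) = ⊥

_≐_ : {A B : Set} → Rel A B → Rel A B → Set
R ≐ S = ∀ a b → (R a b → S a b) × (S a b → R a b)

Subset : Set → Set₁
Subset A = A → Set

img : {A B : Set} → Rel A B → Subset A → Subset B
img R X b = ∃ λ a → X a × R a b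

preimg : {A B : Set} → Subset B → Rel A B → Subset A
preimg Y R a = ∃ λ b → Y b × R a b

_≗S_ : {A : Set} → Subset A → Subset A → Set
X ≗S Y = ∀ a → (X a → Y a) × (Y a → X a)

IsEmpty : {A : Set} → Subset A → Set
IsEmpty X = ∀ a → ¬ X a

record IntObj : Set₁ where
  constructor _,,_
  field
    pos : Set
    neg : Set
open IntObj public

-- a morphism (A⁺,A⁻) → (B⁺,B⁻), i.e. a relation A⁺+B⁻ → B⁺+A⁻,
-- given by its four components
record IntHom (A B : IntObj) : Set₁ where
  constructor mkHom
  field
    r12 : Rel (pos A) (pos B)
    r11 : Rel (pos A) (neg A)
    r21 : Rel (neg B) (neg A)
    r22 : Rel (neg B) (pos B)
open IntHom public

idInt : (A : IntObj) → IntHom A A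
idInt A = mkHom IdR ∅R IdR ∅R

_∘I_ : {A B C : IntObj} → IntHom B C → IntHom A B → IntHom A C
S ∘I R = mkHom
  (r12 S ∙ ((r22 R ∙ r11 S) *) ∙ r12 R)
  (r11 R ∪ (r21 R ∙ r11 S ∙ ((r22 R ∙ r11 S) *) ∙ r12 R))
  (r21 R ∙ ((r11 S ∙ r22 R) *) ∙ r21 S)
  (r22 S ∪ (r12 S ∙ r22 R ∙ ((r11 S ∙ r22 R) *) ∙ r21 S))

_≈I_ : {A B : IntObj} → IntHom A B → IntHom A B → Set
R ≈I S = (r12 R ≐ r12 S) × (r11 R ≐ r11 S) × (r21 R ≐ r21 S) × (r22 R ≐ r22 S)

_⊗IO_ : IntObj → IntObj → IntObj
A ⊗IO C = (pos A ⊎ pos C) ,, (neg A ⊎ neg C)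

_⊗IH_ : {A B C D : IntObj} → IntHom A B → IntHom C D → IntHom (A ⊗IO C) (B ⊗IO D)
R ⊗IH S = mkHom (r12 R ⊕ r12 S) (r11 R ⊕ r11 S) (r21 R ⊕ r21 S) (r22 R ⊕ r22 S)

IInt : IntObj
IInt = ⊥ ,, ⊥

fromFuns : {A B : IntObj} → (pos A → pos B) → (neg B → neg A) → IntHom A B
fromFuns f g = mkHom (graph f) ∅R (graph g) ∅R

assocʳ : {X Y Z : Set} → (X ⊎ Y) ⊎ Z → X ⊎ (Y ⊎ Z)
assocʳ (inj₁ (inj₁ x)) = inj₁ x
assocʳ (inj₁ (inj₂ y)) = inj₂ (inj₁ y)
assocʳ (inj₂ z) = inj₂ (inj₂ z)

assocˡ : {X Y Z : Set} → X ⊎ (Y ⊎ Z) → (X ⊎ Y) ⊎ Z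
assocˡ (inj₁ x) = inj₁ (inj₁ x)
assocˡ (inj₂ (inj₁ y)) = inj₁ (inj₂ y)
assocˡ (inj₂ (inj₂ z)) = inj₂ z

dropˡ : {X : Set} → ⊥ ⊎ X → X
dropˡ = [ ⊥-elim , (λ x → x) ]

dropʳ : {X : Set} → X ⊎ ⊥ → X
dropʳ = [ (λ x → x) , ⊥-elim ]

αInt : (A B C : IntObj) → IntHom ((A ⊗IO B) ⊗IO C) (A ⊗IO (B ⊗IO C))
αInt A B C = fromFuns assocʳ assocˡ

α⁻¹Int : (A B C : IntObj) → IntHom (A ⊗IO (B ⊗IO C)) ((A ⊗IO B) ⊗IO C)
α⁻¹Int A B C = fromFuns assocˡ assocʳ

λInt : (A : IntObj) → IntHom (IInt ⊗IO A) A
λInt A = fromFuns dropˡ inj₂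

λ⁻¹Int : (A : IntObj) → IntHom A (IInt ⊗IO A)
λ⁻¹Int A = fromFuns inj₂ dropˡ

ρInt : (A : IntObj) → IntHom (A ⊗IO IInt) A
ρInt A = fromFuns dropʳ inj₁

ρ⁻¹Int : (A : IntObj) → IntHom A (A ⊗IO IInt)
ρ⁻¹Int A = fromFuns inj₁ dropʳ

record PosObj : Set₁ where
  constructor mkPosObj
  field
    under : IntObj
    mp⁺   : Subset (pos under)
    mp⁻   : Subset (neg under)
open PosObj public

_⊗PO_ : PosObj → PosObj → PosObj
A ⊗PO C = mkPosObj (under A ⊗IO under C)
  [ mp⁺ A , mp⁺ C ] [ mp⁻ A , mp⁻ C ]

IPos : PosObj
IPos = mkPosObj IInt (λ _ → ⊥) (λ _ → ⊥)

record IsPositive (A B : PosObj) (R : IntHom (under A) (under B)) : Set₁ where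
  field
    cond1  : preimg (mp⁺ B) (r12 R) ≗S mp⁺ A
    cond2  : img (r21 R) (mp⁻ B) ≗S mp⁻ A
    cond3a : IsEmpty (preimg (mp⁺ B) (r22 R))
    cond3b : IsEmpty (img (r22 R) (mp⁻ B))

PosHom : PosObj → PosObj → Set₁
PosHom A B = Σ (IntHom (under A) (under B)) (IsPositive A B)

_≈P_ : {A B : PosObj} → PosHom A B → PosHom A B → Set
f ≈P g = proj₁ f ≈I proj₁ g

record IsMonoidalCategory
  (Obj : Set₁) (Hom : Obj → Obj → Set₁)
  (_≈_ : {A B : Obj} → Hom A B → Hom A B → Set)
  (id  : (A : Obj) → Hom A A)
  (_∘_ : {A B C : Obj} → Hom B C → Hom A B → Hom A C)
  (_⊗₀_ : Obj → Obj → Obj)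
  (_⊗₁_ : {A B C D : Obj} → Hom A B → Hom C D → Hom (A ⊗₀ C) (B ⊗₀ D))
  (unit : Obj)
  (α   : (A B C : Obj) → Hom ((A ⊗₀ B) ⊗₀ C) (A ⊗₀ (B ⊗₀ C)))
  (α⁻¹ : (A B C : Obj) → Hom (A ⊗₀ (B ⊗₀ C)) ((A ⊗₀ B) ⊗₀ C))
  (λ′  : (A : Obj) → Hom (unit ⊗₀ A) A)
  (λ⁻¹ : (A : Obj) → Hom A (unit ⊗₀ A))
  (ρ   : (A : Obj) → Hom (A ⊗₀ unit) A)
  (ρ⁻¹ : (A : Obj) → Hom A (A ⊗₀ unit))
  : Set₁ where
  field
    ≈-refl  : {A B : Obj} {f : Hom A B} → f ≈ f
    ≈-sym   : {A B : Obj} {f g : Hom A B} → f ≈ g → g ≈ f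
    ≈-trans : {A B : Obj} {f g h : Hom A B} → f ≈ g → g ≈ h → f ≈ h
    ∘-resp-≈ : {A B C : Obj} {f f′ : Hom B C} {g g′ : Hom A B} →
               f ≈ f′ → g ≈ g′ → (f ∘ g) ≈ (f′ ∘ g′)
    identityˡ : {A B : Obj} (f : Hom A B) → (id B ∘ f) ≈ f
    identityʳ : {A B : Obj} (f : Hom A B) → (f ∘ id A) ≈ f
    assoc : {A B C D : Obj} (f : Hom A B) (g : Hom B C) (h : Hom C D) →
            ((h ∘ g) ∘ f) ≈ (h ∘ (g ∘ f))
    ⊗-resp-≈ : {A B C D : Obj} {f f′ : Hom A B} {g g′ : Hom C D} →
               f ≈ f′ → g ≈ g′ → (f ⊗₁ g) ≈ (f′ ⊗₁ g′)
    ⊗-identity : (A C : Obj) → (id A ⊗₁ id C) ≈ id (A ⊗₀ C)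
    ⊗-homomorphism : {A B C D E F : Obj}
                     (f : Hom A B) (g : Hom B C) (h : Hom D E) (k : Hom E F) →
                     ((g ∘ f) ⊗₁ (k ∘ h)) ≈ ((g ⊗₁ k) ∘ (f ⊗₁ h))
    α-isoˡ : (A B C : Obj) → (α⁻¹ A B C ∘ α A B C) ≈ id ((A ⊗₀ B) ⊗₀ C)
    α-isoʳ : (A B C : Obj) → (α A B C ∘ α⁻¹ A B C) ≈ id (A ⊗₀ (B ⊗₀ C))
    λ-isoˡ : (A : Obj) → (λ⁻¹ A ∘ λ′ A) ≈ id (unit ⊗₀ A)
    λ-isoʳ : (A : Obj) → (λ′ A ∘ λ⁻¹ A) ≈ id A
    ρ-isoˡ : (A : Obj) → (ρ⁻¹ A ∘ ρ A) ≈ id (A ⊗₀ unit)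
    ρ-isoʳ : (A : Obj) → (ρ A ∘ ρ⁻¹ A) ≈ id A
    α-natural : {A A′ B B′ C C′ : Obj} (f : Hom A A′) (g : Hom B B′) (h : Hom C C′) →
                (α A′ B′ C′ ∘ ((f ⊗₁ g) ⊗₁ h)) ≈ ((f ⊗₁ (g ⊗₁ h)) ∘ α A B C)
    λ-natural : {A B : Obj} (f : Hom A B) →
                (λ′ B ∘ (id unit ⊗₁ f)) ≈ (f ∘ λ′ A)
    ρ-natural : {A B : Obj} (f : Hom A B) →
                (ρ B ∘ (f ⊗₁ id unit)) ≈ (f ∘ ρ A)
    pentagon : (A B C D : Obj) →
               ((id A ⊗₁ α B C D) ∘ (α A (B ⊗₀ C) D ∘ (α A B C ⊗₁ id D)))
               ≈ (α A B (C ⊗₀ D) ∘ α (A ⊗₀ B) C D)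
    triangle : (A B : Obj) →
               ((id A ⊗₁ λ′ B) ∘ α A unit B) ≈ (ρ A ⊗₁ id B)

record PosClosure : Set₁ where
  field
    id-pos : (A : PosObj) → IsPositive A A (idInt (under A))
    ∘-pos  : {A B C : PosObj} (S : IntHom (under B) (under C)) (R : IntHom (under A) (under B)) →
             IsPositive B C S → IsPositive A B R → IsPositive A C (S ∘I R)
    ⊗-pos  : {A B C D : PosObj} (R : IntHom (under A) (under B)) (S : IntHom (under C) (under D)) →
             IsPositive A B R → IsPositive C D S →
             IsPositive (A ⊗PO C) (B ⊗PO D) (R ⊗IH S)
    α-pos   : (A B C : PosObj) →
              IsPositive ((A ⊗PO B) ⊗PO C) (A ⊗PO (B ⊗PO C)) (αInt (under A) (under B) (under C))
    α⁻¹-pos : (A B C : PosObj) →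
              IsPositive (A ⊗PO (B ⊗PO C)) ((A ⊗PO B) ⊗PO C) (α⁻¹Int (under A) (under B) (under C))
    λ-pos   : (A : PosObj) → IsPositive (IPos ⊗PO A) A (λInt (under A))
    λ⁻¹-pos : (A : PosObj) → IsPositive A (IPos ⊗PO A) (λ⁻¹Int (under A))
    ρ-pos   : (A : PosObj) → IsPositive (A ⊗PO IPos) A (ρInt (under A))
    ρ⁻¹-pos : (A : PosObj) → IsPositive A (A ⊗PO IPos) (ρ⁻¹Int (under A))

module PosStructure (c : PosClosure) where
  open PosClosure c

  idP : (A : PosObj) → PosHom A A
  idP A = idInt (under A) , id-pos A

  _∘P_ : {A B C : PosObj} → PosHom B C → PosHom A B → PosHom A C
  (S , s) ∘P (R , r) = (S ∘I R) , ∘-pos S R s r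

  _⊗PH_ : {A B C D : PosObj} → PosHom A B → PosHom C D → PosHom (A ⊗PO C) (B ⊗PO D)
  (R , r) ⊗PH (S , s) = (R ⊗IH S) , ⊗-pos R S r s

  αP : (A B C : PosObj) → PosHom ((A ⊗PO B) ⊗PO C) (A ⊗PO (B ⊗PO C))
  αP A B C = αInt (under A) (under B) (under C) , α-pos A B C

  α⁻¹P : (A B C : PosObj) → PosHom (A ⊗PO (B ⊗PO C)) ((A ⊗PO B) ⊗PO C)
  α⁻¹P A B C = α⁻¹Int (under A) (under B) (under C) , α⁻¹-pos A B C

  λP : (A : PosObj) → PosHom (IPos ⊗PO A) A
  λP A = λInt (under A) , λ-pos A

  λ⁻¹P : (A : PosObj) → PosHom A (IPos ⊗PO A)
  λ⁻¹P A = λ⁻¹Int (under A) , λ⁻¹-pos A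

  ρP : (A : PosObj) → PosHom (A ⊗PO IPos) A
  ρP A = ρInt (under A) , ρ-pos A

  ρ⁻¹P : (A : PosObj) → PosHom A (A ⊗PO IPos)
  ρ⁻¹P A = ρ⁻¹Int (under A) , ρ⁻¹-pos A

  IsMonoidalPos : Set₁
  IsMonoidalPos = IsMonoidalCategory PosObj PosHom _≈P_ idP _∘P_ _⊗PO_ _⊗PH_
                    IPos αP α⁻¹P λP λ⁻¹P ρP ρ⁻¹P

-- Writing a morphism of Int(Rel) as one relation A⁺ + B⁻ → B⁺ + A⁻, the composite
-- S ∘I R is the relation realised by an open graph whose hidden nodes B⁺ + B⁻
-- carry the feedback loop between r11 S and r22 R.  Both bracketings of T S R
-- are then realised by a single graph with hidden nodes (B⁺ + B⁻) + (C⁺ + C⁻):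
-- eliminating either block of hidden nodes (the block formula for the Kleene
-- star) gives back the two composites, so composition is associative.  The
-- structural maps are induced by bijections of the carriers, which reduces
-- naturality and coherence to pointwise identities.  Positive maps are closed
-- under all constructions because condition (3) forces every walk around the
-- feedback loop that ends in mp⁺ or starts in mp⁻ to be empty, so conditions
-- (1) and (2) compose.

module Submission where

open import Defs
open import Data.Empty using (⊥; ⊥-elim)
open import Data.Product using (Σ; ∃; _×_; _,_; proj₁; proj₂)
open import Data.Sum using (_⊎_; inj₁; inj₂; [_,_]; map; swap)
open import Data.Sum.Properties using (map-id; swap-↔)
open import Function.Base using (id; _∘_)
open import Function.Bundles using (_↔_; mk↔ₛ′; Inverse)
open import Function.Construct.Identity using (↔-id)
open import Function.Construct.Symmetry using (↔-sym)
open import Relation.Nullary using (¬_)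
open import Relation.Binary.PropositionalEquality using (_≡_; refl; sym; trans; subst; subst₂)
open import Relation.Binary.Construct.Closure.ReflexiveTransitive
  using (Star; ε; _◅_; _◅◅_; gmap; kleisliStar) renaming (map to Star-map)

open Inverse using (to; from; strictlyInverseˡ; strictlyInverseʳ)

infix 2 _⇔_
_⇔_ : Set → Set → Set
P ⇔ Q = (P → Q) × (Q → P)

⇔-refl : {P : Set} → P ⇔ P
⇔-refl = (λ p → p) , (λ p → p)

⇔-sym : {P Q : Set} → P ⇔ Q → Q ⇔ P
⇔-sym (f , g) = g , f

⇔-trans : {P Q R : Set} → P ⇔ Q → Q ⇔ R → P ⇔ R
⇔-trans (f , g) (f′ , g′) = (λ p → f′ (f p)) , (λ r → g (g′ r))

subst-⇔ : {X : Set} (P : X → Set) {x y : X} → x ≡ y → P x ⇔ P y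
subst-⇔ P refl = ⇔-refl

subst₂-⇔ : {U V : Set} (Q : Rel U V) {u u′ : U} {v v′ : V} → u ≡ u′ → v ≡ v′ → Q u v ⇔ Q u′ v′
subst₂-⇔ Q refl refl = ⇔-refl

≐-refl : {A B : Set} {R : Rel A B} → R ≐ R
≐-refl _ _ = ⇔-refl

≐-sym : {A B : Set} {R S : Rel A B} → R ≐ S → S ≐ R
≐-sym R≐S a b = ⇔-sym (R≐S a b)

≐-trans : {A B : Set} {R S T : Rel A B} → R ≐ S → S ≐ T → R ≐ T
≐-trans R≐S S≐T a b = ⇔-trans (R≐S a b) (S≐T a b)

∙-cong : {A B C : Set} {R R′ : Rel B C} {S S′ : Rel A B} →
         R ≐ R′ → S ≐ S′ → (R ∙ S) ≐ (R′ ∙ S′)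
∙-cong R≐R′ S≐S′ a c =
    (λ (b , s , r) → b , proj₁ (S≐S′ a b) s , proj₁ (R≐R′ b c) r)
  , (λ (b , s , r) → b , proj₂ (S≐S′ a b) s , proj₂ (R≐R′ b c) r)

∪-cong : {A B : Set} {R R′ S S′ : Rel A B} → R ≐ R′ → S ≐ S′ → (R ∪ S) ≐ (R′ ∪ S′)
∪-cong R≐R′ S≐S′ a b =
    (λ { (inj₁ r) → inj₁ (proj₁ (R≐R′ a b) r) ; (inj₂ s) → inj₂ (proj₁ (S≐S′ a b) s) })
  , (λ { (inj₁ r) → inj₁ (proj₂ (R≐R′ a b) r) ; (inj₂ s) → inj₂ (proj₂ (S≐S′ a b) s) })

*-cong : {A : Set} {R S : Rel A A} → R ≐ S → (R *) ≐ (S *)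
*-cong R≐S _ _ = Star-map (λ {a} {b} → proj₁ (R≐S a b)) , Star-map (λ {a} {b} → proj₂ (R≐S a b))

⊕-cong : {A B C D : Set} {R R′ : Rel A B} {S S′ : Rel C D} →
         R ≐ R′ → S ≐ S′ → (R ⊕ S) ≐ (R′ ⊕ S′)
⊕-cong R≐R′ S≐S′ (inj₁ a) (inj₁ b) = R≐R′ a b
⊕-cong R≐R′ S≐S′ (inj₂ c) (inj₂ d) = S≐S′ c d
⊕-cong R≐R′ S≐S′ (inj₁ _) (inj₂ _) = ⇔-refl
⊕-cong R≐R′ S≐S′ (inj₂ _) (inj₁ _) = ⇔-refl

∙-identityˡ : {A B : Set} {R : Rel A B} → (IdR ∙ R) ≐ R
∙-identityˡ _ _ = (λ { (_ , r , refl) → r }) , (λ r → _ , r , refl)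

∙-identityʳ : {A B : Set} {R : Rel A B} → (R ∙ IdR) ≐ R
∙-identityʳ _ _ = (λ { (_ , refl , r) → r }) , (λ r → _ , refl , r)

graph-∙ : {A B C : Set} (f : A → B) (g : B → C) → (graph g ∙ graph f) ≐ graph (g ∘ f)
graph-∙ f g _ _ = (λ { (_ , refl , eq) → eq }) , (λ eq → _ , refl , eq)

graph-cong : {A B : Set} {f g : A → B} → (∀ a → f a ≡ g a) → graph f ≐ graph g
graph-cong f≗g a _ = (λ eq → trans (sym (f≗g a)) eq) , (λ eq → trans (f≗g a) eq)

image-↔ : {B C : Set} (β : B ↔ C) (P : B → Set) (c : C) → (∃ λ b → P b × to β b ≡ c) ⇔ P (from β c)
image-↔ β P c = (λ { (b , p , refl) → subst P (sym (strictlyInverseʳ β b)) p })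
              , (λ p → from β c , p , strictlyInverseˡ β c)

preimage-graph : {A B : Set} (f : A → B) (P : B → Set) (a : A) → (∃ λ b → f a ≡ b × P b) ⇔ P (f a)
preimage-graph f P a = (λ { (_ , refl , p) → p }) , (λ p → f a , refl , p)

graph-⊕ : {A B C D : Set} (f : A → B) (g : C → D) → (graph f ⊕ graph g) ≐ graph (map f g)
graph-⊕ f g (inj₁ a) (inj₁ b) = (λ { refl → refl }) , (λ { refl → refl })
graph-⊕ f g (inj₂ c) (inj₂ d) = (λ { refl → refl }) , (λ { refl → refl })
graph-⊕ f g (inj₁ _) (inj₂ _) = (λ ()) , (λ ())
graph-⊕ f g (inj₂ _) (inj₁ _) = (λ ()) , (λ ())

∅-⊕ : {A B C D : Set} → (∅R {A} {B} ⊕ ∅R {C} {D}) ≐ ∅R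
∅-⊕ (inj₁ _) (inj₁ _) = ⇔-refl
∅-⊕ (inj₂ _) (inj₂ _) = ⇔-refl
∅-⊕ (inj₁ _) (inj₂ _) = (λ ()) , (λ ())
∅-⊕ (inj₂ _) (inj₁ _) = (λ ()) , (λ ())

⊕-∙ : {A B C A′ B′ C′ : Set} {R : Rel B C} {S : Rel B′ C′} {R′ : Rel A B} {S′ : Rel A′ B′} →
      ((R ⊕ S) ∙ (R′ ⊕ S′)) ≐ ((R ∙ R′) ⊕ (S ∙ S′))
⊕-∙ (inj₁ _) (inj₁ _) = (λ { (inj₁ b , p , q) → b , p , q }) , (λ (b , p , q) → inj₁ b , p , q)
⊕-∙ (inj₂ _) (inj₂ _) = (λ { (inj₂ b , p , q) → b , p , q }) , (λ (b , p , q) → inj₂ b , p , q)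
⊕-∙ (inj₁ _) (inj₂ _) = (λ { (inj₁ _ , _ , ()) ; (inj₂ _ , () , _) }) , (λ ())
⊕-∙ (inj₂ _) (inj₁ _) = (λ { (inj₂ _ , _ , ()) ; (inj₁ _ , () , _) }) , (λ ())

⊕-∪ : {A B A′ B′ : Set} {R R′ : Rel A B} {S S′ : Rel A′ B′} →
      ((R ⊕ S) ∪ (R′ ⊕ S′)) ≐ ((R ∪ R′) ⊕ (S ∪ S′))
⊕-∪ (inj₁ _) (inj₁ _) = ⇔-refl
⊕-∪ (inj₂ _) (inj₂ _) = ⇔-refl
⊕-∪ (inj₁ _) (inj₂ _) = (λ { (inj₁ ()) ; (inj₂ ()) }) , (λ ())
⊕-∪ (inj₂ _) (inj₁ _) = (λ { (inj₁ ()) ; (inj₂ ()) }) , (λ ())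

module _ {A B : Set} {R : Rel A A} {S : Rel B B} where
  private
    project₁ : ∀ {a a′} → Star (R ⊕ S) (inj₁ a) (inj₁ a′) → Star R a a′
    project₁ ε = ε
    project₁ (_◅_ {j = inj₁ _} ρ w) = ρ ◅ project₁ w
    project₂ : ∀ {b b′} → Star (R ⊕ S) (inj₂ b) (inj₂ b′) → Star S b b′
    project₂ ε = ε
    project₂ (_◅_ {j = inj₂ _} σ w) = σ ◅ project₂ w
    no-cross₁₂ : ∀ {a b} → Star (R ⊕ S) (inj₁ a) (inj₂ b) → ⊥
    no-cross₁₂ (_◅_ {j = inj₁ _} _ w) = no-cross₁₂ w
    no-cross₂₁ : ∀ {b a} → Star (R ⊕ S) (inj₂ b) (inj₁ a) → ⊥
    no-cross₂₁ (_◅_ {j = inj₂ _} _ w) = no-cross₂₁ w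

  ⊕-* : ((R ⊕ S) *) ≐ ((R *) ⊕ (S *))
  ⊕-* (inj₁ _) (inj₁ _) = project₁ , gmap inj₁ id
  ⊕-* (inj₂ _) (inj₂ _) = project₂ , gmap inj₂ id
  ⊕-* (inj₁ _) (inj₂ _) = no-cross₁₂ , λ ()
  ⊕-* (inj₂ _) (inj₁ _) = no-cross₂₁ , λ ()

⊕-∙*∙ : {A B C D A′ B′ C′ D′ : Set}
        {X : Rel C D} {Y : Rel B C} {Z : Rel C B} {W : Rel A C}
        {X′ : Rel C′ D′} {Y′ : Rel B′ C′} {Z′ : Rel C′ B′} {W′ : Rel A′ C′} →
        ((X ⊕ X′) ∙ ((Y ⊕ Y′) ∙ (Z ⊕ Z′)) * ∙ (W ⊕ W′))
        ≐ ((X ∙ (Y ∙ Z) * ∙ W) ⊕ (X′ ∙ (Y′ ∙ Z′) * ∙ W′))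
⊕-∙*∙ = ≐-trans (∙-cong ≐-refl (≐-trans (∙-cong (≐-trans (*-cong ⊕-∙) ⊕-*) ≐-refl) ⊕-∙)) ⊕-∙

⊕-∪-∙ : {A B C D A′ B′ C′ D′ : Set} {U : Rel A D} {V : Rel B D}
        {X : Rel C B} {Y : Rel B C} {Z : Rel C B} {W : Rel A C}
        {U′ : Rel A′ D′} {V′ : Rel B′ D′}
        {X′ : Rel C′ B′} {Y′ : Rel B′ C′} {Z′ : Rel C′ B′} {W′ : Rel A′ C′} →
        ((U ⊕ U′) ∪ ((V ⊕ V′) ∙ (X ⊕ X′) ∙ ((Y ⊕ Y′) ∙ (Z ⊕ Z′)) * ∙ (W ⊕ W′)))
        ≐ ((U ∪ (V ∙ X ∙ (Y ∙ Z) * ∙ W)) ⊕ (U′ ∪ (V′ ∙ X′ ∙ (Y′ ∙ Z′) * ∙ W′)))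
⊕-∪-∙ = ≐-trans (∪-cong ≐-refl (≐-trans (∙-cong ≐-refl ⊕-∙*∙) ⊕-∙)) ⊕-∪

bipartite : {X Y : Set} → Rel X Y → Rel Y X → Rel (X ⊎ Y) (X ⊎ Y)
bipartite p q (inj₁ x) (inj₂ y) = p x y
bipartite p q (inj₂ y) (inj₁ x) = q y x
bipartite p q (inj₁ _) (inj₁ _) = ⊥
bipartite p q (inj₂ _) (inj₂ _) = ⊥

module _ {X Y : Set} (p : Rel X Y) (q : Rel Y X) where

  *-slide : (p ∙ (q ∙ p) *) ≐ ((p ∙ q) * ∙ p)
  *-slide _ _ = (λ (_ , w , r) → slideʳ w r) , (λ (_ , r , w) → slideˡ r w)
    where
    slideʳ : ∀ {x x′ y} → Star (q ∙ p) x x′ → p x′ y → ((p ∙ q) * ∙ p) x y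
    slideʳ ε r = _ , r , ε
    slideʳ ((y₁ , r₁ , s₁) ◅ w) r =
      let (y₂ , r₂ , w′) = slideʳ w r in y₁ , r₁ , ((_ , s₁ , r₂) ◅ w′)
    slideˡ : ∀ {x y₀ y} → p x y₀ → Star (p ∙ q) y₀ y → (p ∙ (q ∙ p) *) x y
    slideˡ r ε = _ , ε , r
    slideˡ r ((x₁ , s₁ , r₁) ◅ w) =
      let (x′ , w′ , r′) = slideˡ r₁ w in x′ , ((_ , r , s₁) ◅ w′) , r′

  private
    leave₁₁ : ∀ {x x′} → Star (bipartite p q) (inj₁ x) (inj₁ x′) → Star (q ∙ p) x x′
    leave₁₂ : ∀ {x y} → Star (bipartite p q) (inj₁ x) (inj₂ y) → ((p ∙ q) * ∙ p) x y
    leave₂₁ : ∀ {y x} → Star (bipartite p q) (inj₂ y) (inj₁ x) → ((q ∙ p) * ∙ q) y x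
    leave₂₂ : ∀ {y y′} → Star (bipartite p q) (inj₂ y) (inj₂ y′) → Star (p ∙ q) y y′
    leave₁₁ ε = ε
    leave₁₁ (_◅_ {j = inj₂ y} r w) = let (x₁ , s , w′) = leave₂₁ w in (y , r , s) ◅ w′
    leave₁₂ (_◅_ {j = inj₂ y} r w) = y , r , leave₂₂ w
    leave₂₁ (_◅_ {j = inj₁ x} s w) = x , s , leave₁₁ w
    leave₂₂ ε = ε
    leave₂₂ (_◅_ {j = inj₁ x} s w) = let (y₁ , r , w′) = leave₁₂ w in (x , s , r) ◅ w′

    enter₁₁ : ∀ {x x′} → Star (q ∙ p) x x′ → Star (bipartite p q) (inj₁ x) (inj₁ x′)
    enter₁₁ ε = ε
    enter₁₁ ((y , r , s) ◅ w) = _◅_ {j = inj₂ y} r (_◅_ {j = inj₁ _} s (enter₁₁ w))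
    enter₂₂ : ∀ {y y′} → Star (p ∙ q) y y′ → Star (bipartite p q) (inj₂ y) (inj₂ y′)
    enter₂₂ ε = ε
    enter₂₂ ((x , s , r) ◅ w) = _◅_ {j = inj₁ x} s (_◅_ {j = inj₂ _} r (enter₂₂ w))

  bipartite-*₁₁ : ∀ {x x′} → Star (bipartite p q) (inj₁ x) (inj₁ x′) ⇔ Star (q ∙ p) x x′
  bipartite-*₁₁ = leave₁₁ , enter₁₁

  bipartite-*₁₂ : ∀ {x y} → Star (bipartite p q) (inj₁ x) (inj₂ y) ⇔ ((p ∙ q) * ∙ p) x y
  bipartite-*₁₂ = leave₁₂ , λ (y₁ , r , w) → _◅_ {j = inj₂ y₁} r (enter₂₂ w)

  bipartite-*₂₁ : ∀ {y x} → Star (bipartite p q) (inj₂ y) (inj₁ x) ⇔ ((q ∙ p) * ∙ q) y x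
  bipartite-*₂₁ = leave₂₁ , λ (x₁ , s , w) → _◅_ {j = inj₁ x₁} s (enter₁₁ w)

  bipartite-*₂₂ : ∀ {y y′} → Star (bipartite p q) (inj₂ y) (inj₂ y′) ⇔ Star (p ∙ q) y y′
  bipartite-*₂₂ = leave₂₂ , enter₂₂

module _ {X : Set} {P : Rel X X} {M : Subset X} where

  Star-into-unreachable : (∀ {y z} → P y z → ¬ M z) → ∀ {y z} → Star P y z → M z → y ≡ z
  Star-into-unreachable _ ε _ = refl
  Star-into-unreachable unreachable (p ◅ w) m with Star-into-unreachable unreachable w m
  ... | refl = ⊥-elim (unreachable p m)

  Star-from-inescapable : (∀ {y z} → P y z → ¬ M y) → ∀ {y z} → M y → Star P y z → y ≡ z
  Star-from-inescapable _ _ ε = refl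
  Star-from-inescapable inescapable m (p ◅ _) = ⊥-elim (inescapable p m)

-- Open graphs

-- An open graph with inputs I, outputs O and hidden nodes H has edges
-- d : I → O, e : I → H, s : H → H and x : H → O.
data Flow {I O H : Set} (d : Rel I O) (e : Rel I H) (s : Rel H H) (x : Rel H O) (i : I) (o : O) : Set where
  edge : d i o → Flow d e s x i o
  walk : (x ∙ s * ∙ e) i o → Flow d e s x i o

module _ {I O H : Set} {d : Rel I O} {e : Rel I H} {s : Rel H H} {x : Rel H O} where

  Flow-cong : {d′ : Rel I O} {e′ : Rel I H} {s′ : Rel H H} {x′ : Rel H O} →
              d ≐ d′ → e ≐ e′ → s ≐ s′ → x ≐ x′ → Flow d e s x ≐ Flow d′ e′ s′ x′
  Flow-cong d≐ e≐ s≐ x≐ i o =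
      (λ { (edge δ) → edge (proj₁ (d≐ i o) δ) ; (walk ω) → walk (proj₁ (walk≐ i o) ω) })
    , (λ { (edge δ) → edge (proj₂ (d≐ i o) δ) ; (walk ω) → walk (proj₂ (walk≐ i o) ω) })
    where walk≐ = ∙-cong x≐ (∙-cong (*-cong s≐) e≐)

  Flow-pointwise : {I′ O′ : Set} {d′ : Rel I′ O′} {e′ : Rel I′ H} {x′ : Rel H O′}
                   {i : I} {o : O} {i′ : I′} {o′ : O′} →
                   (d i o ⇔ d′ i′ o′) → (∀ h → e i h ⇔ e′ i′ h) → (∀ h → x h o ⇔ x′ h o′) →
                   Flow d e s x i o ⇔ Flow d′ e′ s x′ i′ o′
  Flow-pointwise d⇔ e⇔ x⇔ =
      (λ { (edge δ) → edge (proj₁ d⇔ δ)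
         ; (walk (h′ , (h , η , w) , ξ)) → walk (h′ , (h , proj₁ (e⇔ h) η , w) , proj₁ (x⇔ h′) ξ) })
    , (λ { (edge δ) → edge (proj₂ d⇔ δ)
         ; (walk (h′ , (h , η , w) , ξ)) → walk (h′ , (h , proj₂ (e⇔ h) η , w) , proj₂ (x⇔ h′) ξ) })

  Flow-no-entry : {i : I} {o : O} → (∀ h → ¬ e i h) → Flow d e s x i o ⇔ d i o
  Flow-no-entry no = (λ { (edge δ) → δ ; (walk (_ , (h , η , _) , _)) → ⊥-elim (no h η) }) , edge

  Flow-no-exit : {i : I} {o : O} → (∀ h → ¬ x h o) → Flow d e s x i o ⇔ d i o
  Flow-no-exit no = (λ { (edge δ) → δ ; (walk (h′ , _ , ξ)) → ⊥-elim (no h′ ξ) }) , edge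

Flow-reindex : {I O H H′ : Set} (φ : H ↔ H′) (d : Rel I O) (e : Rel I H) (s : Rel H H) (x : Rel H O) →
               Flow d e s x ≐ Flow d (λ i h → e i (from φ h)) (λ h h′ → s (from φ h) (from φ h′))
                                     (λ h o → x (from φ h) o)
Flow-reindex φ d e s x i o =
    (λ { (edge δ) → edge δ
       ; (walk (h′ , (h , η , w) , ξ)) →
           walk (to φ h′ , (to φ h , subst (e i) (back h) η , gmap (to φ) forth w)
                , subst (λ h → x h o) (back h′) ξ) })
  , (λ { (edge δ) → edge δ
       ; (walk (h′ , (h , η , w) , ξ)) → walk (from φ h′ , (from φ h , η , gmap (from φ) id w) , ξ) })
  where
  back : ∀ h → h ≡ from φ (to φ h)
  back h = sym (strictlyInverseʳ φ h)
  forth : ∀ {h h′} → s h h′ → s (from φ (to φ h)) (from φ (to φ h′))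
  forth = subst₂ s (back _) (back _)

-- Eliminating the hidden nodes H₂: a walk through H₁ + H₂ is a walk through H₁
-- whose steps may detour through H₂ (the block formula for the Kleene star).
module Elimination {I O H₁ H₂ : Set} (d : Rel I O) (e : Rel I (H₁ ⊎ H₂))
                   (s : Rel (H₁ ⊎ H₂) (H₁ ⊎ H₂)) (x : Rel (H₁ ⊎ H₂) O) where

  e₁ : Rel I H₁
  e₁ i h = e i (inj₁ h)
  e₂ : Rel I H₂
  e₂ i k = e i (inj₂ k)
  s₁₁ : Rel H₁ H₁
  s₁₁ h h′ = s (inj₁ h) (inj₁ h′)
  s₁₂ : Rel H₁ H₂
  s₁₂ h k = s (inj₁ h) (inj₂ k)
  s₂₁ : Rel H₂ H₁
  s₂₁ k h = s (inj₂ k) (inj₁ h)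
  s₂₂ : Rel H₂ H₂
  s₂₂ k k′ = s (inj₂ k) (inj₂ k′)
  x₁ : Rel H₁ O
  x₁ h o = x (inj₁ h) o
  x₂ : Rel H₂ O
  x₂ k o = x (inj₂ k) o

  direct′ : Rel I O
  direct′ = Flow d e₂ s₂₂ x₂
  entry′ : Rel I H₁
  entry′ = Flow e₁ e₂ s₂₂ s₂₁
  loop′ : Rel H₁ H₁
  loop′ = Flow s₁₁ s₁₂ s₂₂ s₂₁
  exit′ : Rel H₁ O
  exit′ = Flow x₁ s₁₂ s₂₂ x₂

  split₁₁ : ∀ {h h′} → Star s (inj₁ h) (inj₁ h′) → (loop′ *) h h′
  split₁₂ : ∀ {h k} → Star s (inj₁ h) (inj₂ k) → (s₂₂ * ∙ s₁₂ ∙ loop′ *) h k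
  split₂₁ : ∀ {k h} → Star s (inj₂ k) (inj₁ h) → (loop′ * ∙ s₂₁ ∙ s₂₂ *) k h
  split₂₂ : ∀ {k k′} → Star s (inj₂ k) (inj₂ k′) →
            (s₂₂ * ∪ (s₂₂ * ∙ s₁₂ ∙ loop′ * ∙ s₂₁ ∙ s₂₂ *)) k k′
  split₁₁ ε = ε
  split₁₁ (_◅_ {j = inj₁ _} σ w) = edge σ ◅ split₁₁ w
  split₁₁ (_◅_ {j = inj₂ k} σ w) =
    let (h₀ , (k′ , w₂₂ , σ′) , ws) = split₂₁ w in walk (k′ , (k , σ , w₂₂) , σ′) ◅ ws
  split₁₂ (_◅_ {j = inj₁ _} σ w) =
    let (k₀ , (h′ , ws , σ′) , w₂₂) = split₁₂ w in k₀ , (h′ , edge σ ◅ ws , σ′) , w₂₂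
  split₁₂ (_◅_ {j = inj₂ k} σ w) with split₂₂ w
  ... | inj₁ w₂₂ = k , (_ , ε , σ) , w₂₂
  ... | inj₂ (k₂ , (h₁ , (h₀ , (k₁ , w₁ , σ′) , ws) , σ₂) , w₂) =
    k₂ , (h₁ , walk (k₁ , (k , σ , w₁) , σ′) ◅ ws , σ₂) , w₂
  split₂₁ (_◅_ {j = inj₁ h} σ w) = h , (_ , ε , σ) , split₁₁ w
  split₂₁ (_◅_ {j = inj₂ _} σ w) =
    let (h₀ , (k₁ , w₁ , σ′) , ws) = split₂₁ w in h₀ , (k₁ , σ ◅ w₁ , σ′) , ws
  split₂₂ ε = inj₁ ε
  split₂₂ (_◅_ {j = inj₁ h} σ w) =
    let (k₂ , (h₁ , ws , σ₂) , w₂) = split₁₂ w in inj₂ (k₂ , (h₁ , (h , (_ , ε , σ) , ws) , σ₂) , w₂)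
  split₂₂ (_◅_ {j = inj₂ _} σ w) with split₂₂ w
  ... | inj₁ w₂₂ = inj₁ (σ ◅ w₂₂)
  ... | inj₂ (k₂ , (h₁ , (h₀ , (k₁ , w₁ , σ′) , ws) , σ₂) , w₂) =
    inj₂ (k₂ , (h₁ , (h₀ , (k₁ , σ ◅ w₁ , σ′) , ws) , σ₂) , w₂)

  embed₂ : ∀ {k k′} → Star s₂₂ k k′ → Star s (inj₂ k) (inj₂ k′)
  embed₂ = gmap inj₂ (λ σ → σ)

  unfold-loop′ : ∀ {h h′} → loop′ h h′ → Star s (inj₁ h) (inj₁ h′)
  unfold-loop′ (edge σ) = σ ◅ ε
  unfold-loop′ (walk (_ , (_ , σ , w) , σ′)) = σ ◅ (embed₂ w ◅◅ (σ′ ◅ ε))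

  unfold-entry′ : ∀ {i h} → entry′ i h → (s * ∙ e) i (inj₁ h)
  unfold-entry′ (edge η) = _ , η , ε
  unfold-entry′ (walk (_ , (k , η , w) , σ)) = inj₂ k , η , (embed₂ w ◅◅ (σ ◅ ε))

  unfold-exit′ : ∀ {h o} → exit′ h o → (x ∙ s *) (inj₁ h) o
  unfold-exit′ (edge ξ) = _ , ε , ξ
  unfold-exit′ (walk (k′ , (_ , σ , w) , ξ)) = inj₂ k′ , (σ ◅ embed₂ w) , ξ

  Flow-eliminate : Flow d e s x ≐ Flow direct′ entry′ loop′ exit′
  Flow-eliminate i o =
      (λ { (edge δ) → edge (edge δ)
         ; (walk (inj₁ h′ , (inj₁ h , η , w) , ξ)) → walk (h′ , (h , edge η , split₁₁ w) , edge ξ)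
         ; (walk (inj₂ k , (inj₁ h , η , w) , ξ)) →
             let (k₀ , (h′ , ws , σ) , w₂₂) = split₁₂ w
             in walk (h′ , (h , edge η , ws) , walk (k , (k₀ , σ , w₂₂) , ξ))
         ; (walk (inj₁ h , (inj₂ k , η , w) , ξ)) →
             let (h₀ , (k′ , w₂₂ , σ) , ws) = split₂₁ w
             in walk (h , (h₀ , walk (k′ , (k , η , w₂₂) , σ) , ws) , edge ξ)
         ; (walk (inj₂ k′ , (inj₂ k , η , w) , ξ)) → through₂₂ η ξ (split₂₂ w) })
    , (λ { (edge (edge δ)) → edge δ
         ; (edge (walk (k′ , (k , η , w) , ξ))) → walk (inj₂ k′ , (inj₂ k , η , embed₂ w) , ξ)
         ; (walk (_ , (_ , η′ , w) , ξ′)) →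
             let (u , η , w₀) = unfold-entry′ η′
                 (v , w₁ , ξ) = unfold-exit′ ξ′
             in walk (v , (u , η , (w₀ ◅◅ kleisliStar inj₁ unfold-loop′ w ◅◅ w₁)) , ξ) })
    where
    through₂₂ : ∀ {k k′} → e₂ i k → x₂ k′ o →
                (s₂₂ * ∪ (s₂₂ * ∙ s₁₂ ∙ loop′ * ∙ s₂₁ ∙ s₂₂ *)) k k′ → Flow direct′ entry′ loop′ exit′ i o
    through₂₂ η ξ (inj₁ w₂₂) = edge (walk (_ , (_ , η , w₂₂) , ξ))
    through₂₂ η ξ (inj₂ (k₂ , (h₁ , (h₀ , (k₁ , w₁ , σ) , ws) , σ₂) , w₂)) =
      walk (h₁ , (h₀ , walk (k₁ , (_ , η , w₁) , σ) , ws) , walk (_ , (k₂ , σ₂ , w₂) , ξ))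

-- Int(Rel)

≈I-refl : {A B : IntObj} {f : IntHom A B} → f ≈I f
≈I-refl = ≐-refl , ≐-refl , ≐-refl , ≐-refl

≈I-sym : {A B : IntObj} {f g : IntHom A B} → f ≈I g → g ≈I f
≈I-sym (p , q , r , s) = ≐-sym p , ≐-sym q , ≐-sym r , ≐-sym s

≈I-trans : {A B : IntObj} {f g h : IntHom A B} → f ≈I g → g ≈I h → f ≈I h
≈I-trans (p , q , r , s) (p′ , q′ , r′ , s′) = ≐-trans p p′ , ≐-trans q q′ , ≐-trans r r′ , ≐-trans s s′

∘I-cong : {A B C : IntObj} {S S′ : IntHom B C} {R R′ : IntHom A B} →
          S ≈I S′ → R ≈I R′ → (S ∘I R) ≈I (S′ ∘I R′)
∘I-cong (s₁₂ , s₁₁ , s₂₁ , s₂₂) (r₁₂ , r₁₁ , r₂₁ , r₂₂) =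
    ∙-cong s₁₂ (∙-cong (*-cong (∙-cong r₂₂ s₁₁)) r₁₂)
  , ∪-cong r₁₁ (∙-cong r₂₁ (∙-cong s₁₁ (∙-cong (*-cong (∙-cong r₂₂ s₁₁)) r₁₂)))
  , ∙-cong r₂₁ (∙-cong (*-cong (∙-cong s₁₁ r₂₂)) s₂₁)
  , ∪-cong s₂₂ (∙-cong s₁₂ (∙-cong r₂₂ (∙-cong (*-cong (∙-cong s₁₁ r₂₂)) s₂₁)))

⊗IH-cong : {A B C D : IntObj} {R R′ : IntHom A B} {S S′ : IntHom C D} →
           R ≈I R′ → S ≈I S′ → (R ⊗IH S) ≈I (R′ ⊗IH S′)
⊗IH-cong (p , q , r , s) (p′ , q′ , r′ , s′) = ⊕-cong p p′ , ⊕-cong q q′ , ⊕-cong r r′ , ⊕-cong s s′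

-- The paper's form of a morphism: one relation A⁺ + B⁻ → B⁺ + A⁻.
toRel : {A B : IntObj} → IntHom A B → Rel (pos A ⊎ neg B) (pos B ⊎ neg A)
toRel R (inj₁ a) (inj₁ b) = r12 R a b
toRel R (inj₁ a) (inj₂ a′) = r11 R a a′
toRel R (inj₂ b′) (inj₁ b) = r22 R b′ b
toRel R (inj₂ b′) (inj₂ a′) = r21 R b′ a′

toRel-≐⇒≈I : {A B : IntObj} {R S : IntHom A B} → toRel R ≐ toRel S → R ≈I S
toRel-≐⇒≈I R≐S = (λ a b → R≐S (inj₁ a) (inj₁ b)) , (λ a a′ → R≐S (inj₁ a) (inj₂ a′))
               , (λ b′ a′ → R≐S (inj₂ b′) (inj₂ a′)) , (λ b′ b → R≐S (inj₂ b′) (inj₁ b))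

module CompositeGraph {A B C : IntObj} (R : IntHom A B) (S : IntHom B C) where

  direct : Rel (pos A ⊎ neg C) (pos C ⊎ neg A)
  direct (inj₁ a) (inj₂ a′) = r11 R a a′
  direct (inj₂ c′) (inj₁ c) = r22 S c′ c
  direct (inj₁ _) (inj₁ _) = ⊥
  direct (inj₂ _) (inj₂ _) = ⊥

  entry : Rel (pos A ⊎ neg C) (pos B ⊎ neg B)
  entry (inj₁ a) (inj₁ b) = r12 R a b
  entry (inj₂ c′) (inj₂ b′) = r21 S c′ b′
  entry (inj₁ _) (inj₂ _) = ⊥
  entry (inj₂ _) (inj₁ _) = ⊥

  loop : Rel (pos B ⊎ neg B) (pos B ⊎ neg B)
  loop = bipartite (r11 S) (r22 R)

  exit : Rel (pos B ⊎ neg B) (pos C ⊎ neg A)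
  exit (inj₁ b) (inj₁ c) = r12 S b c
  exit (inj₂ b′) (inj₂ a′) = r21 R b′ a′
  exit (inj₁ _) (inj₂ _) = ⊥
  exit (inj₂ _) (inj₁ _) = ⊥

  toRel-∘I : toRel (S ∘I R) ≐ Flow direct entry loop exit
  toRel-∘I (inj₁ a) (inj₁ c) =
      (λ (b , (b₀ , ρ , w) , σ) → walk (inj₁ b , (inj₁ b₀ , ρ , proj₂ (bipartite-*₁₁ _ _) w) , σ))
    , (λ { (edge ())
         ; (walk (inj₁ b , (inj₁ b₀ , ρ , w) , σ)) → b , (b₀ , ρ , proj₁ (bipartite-*₁₁ _ _) w) , σ
         ; (walk (_ , (inj₂ _ , () , _) , _))
         ; (walk (inj₂ _ , (inj₁ _ , _ , _) , ())) })
  toRel-∘I (inj₁ a) (inj₂ a′) =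
      (λ { (inj₁ δ) → edge δ
         ; (inj₂ (b′ , (b , (b₀ , ρ , w) , σ) , ρ′)) →
             walk (inj₂ b′ , (inj₁ b₀ , ρ , proj₂ (bipartite-*₁₂ _ _)
                                               (proj₁ (*-slide (r11 S) (r22 R) b₀ b′) (b , w , σ))) , ρ′) })
    , (λ { (edge δ) → inj₁ δ
         ; (walk (inj₂ b′ , (inj₁ b₀ , ρ , w) , ρ′)) →
             let (b , w′ , σ) = proj₂ (*-slide (r11 S) (r22 R) b₀ b′) (proj₁ (bipartite-*₁₂ _ _) w)
             in inj₂ (b′ , (b , (b₀ , ρ , w′) , σ) , ρ′)
         ; (walk (_ , (inj₂ _ , () , _) , _))
         ; (walk (inj₁ _ , (inj₁ _ , _ , _) , ())) })
  toRel-∘I (inj₂ c′) (inj₁ c) =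
      (λ { (inj₁ δ) → edge δ
         ; (inj₂ (b , (b′ , (b₀′ , σ , w) , ρ) , σ′)) →
             walk (inj₁ b , (inj₂ b₀′ , σ , proj₂ (bipartite-*₂₁ _ _)
                                              (proj₁ (*-slide (r22 R) (r11 S) b₀′ b) (b′ , w , ρ))) , σ′) })
    , (λ { (edge δ) → inj₁ δ
         ; (walk (inj₁ b , (inj₂ b₀′ , σ , w) , σ′)) →
             let (b′ , w′ , ρ) = proj₂ (*-slide (r22 R) (r11 S) b₀′ b) (proj₁ (bipartite-*₂₁ _ _) w)
             in inj₂ (b , (b′ , (b₀′ , σ , w′) , ρ) , σ′)
         ; (walk (_ , (inj₁ _ , () , _) , _))
         ; (walk (inj₂ _ , (inj₂ _ , _ , _) , ())) })
  toRel-∘I (inj₂ c′) (inj₂ a′) =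
      (λ (b′ , (b₀′ , σ , w) , ρ) → walk (inj₂ b′ , (inj₂ b₀′ , σ , proj₂ (bipartite-*₂₂ _ _) w) , ρ))
    , (λ { (edge ())
         ; (walk (inj₂ b′ , (inj₂ b₀′ , σ , w) , ρ)) → b′ , (b₀′ , σ , proj₁ (bipartite-*₂₂ _ _) w) , ρ
         ; (walk (_ , (inj₁ _ , () , _) , _))
         ; (walk (inj₁ _ , (inj₂ _ , _ , _) , ())) })

-- Both bracketings of T S R are realised by one graph with hidden nodes
-- (B⁺ + B⁻) + (C⁺ + C⁻); eliminating C⁺ + C⁻, resp. B⁺ + B⁻, recovers them.
module Associativity {A B C D : IntObj} (R : IntHom A B) (S : IntHom B C) (T : IntHom C D) where

  private
    HB = pos B ⊎ neg B
    HC = pos C ⊎ neg C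
    In = pos A ⊎ neg D
    Out = pos D ⊎ neg A

  direct : Rel In Out
  direct (inj₁ a) (inj₂ a′) = r11 R a a′
  direct (inj₂ d′) (inj₁ d) = r22 T d′ d
  direct (inj₁ _) (inj₁ _) = ⊥
  direct (inj₂ _) (inj₂ _) = ⊥

  entry : Rel In (HB ⊎ HC)
  entry (inj₁ a) (inj₁ (inj₁ b)) = r12 R a b
  entry (inj₂ d′) (inj₂ (inj₂ c′)) = r21 T d′ c′
  entry (inj₁ _) (inj₁ (inj₂ _)) = ⊥
  entry (inj₁ _) (inj₂ _) = ⊥
  entry (inj₂ _) (inj₁ _) = ⊥
  entry (inj₂ _) (inj₂ (inj₁ _)) = ⊥

  loop : Rel (HB ⊎ HC) (HB ⊎ HC)
  loop (inj₁ u) (inj₁ v) = CompositeGraph.loop R S u v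
  loop (inj₂ u) (inj₂ v) = CompositeGraph.loop S T u v
  loop (inj₁ (inj₁ b)) (inj₂ (inj₁ c)) = r12 S b c
  loop (inj₂ (inj₂ c′)) (inj₁ (inj₂ b′)) = r21 S c′ b′
  loop (inj₁ (inj₁ _)) (inj₂ (inj₂ _)) = ⊥
  loop (inj₁ (inj₂ _)) (inj₂ _) = ⊥
  loop (inj₂ (inj₁ _)) (inj₁ _) = ⊥
  loop (inj₂ (inj₂ _)) (inj₁ (inj₁ _)) = ⊥

  exit : Rel (HB ⊎ HC) Out
  exit (inj₁ (inj₂ b′)) (inj₂ a′) = r21 R b′ a′
  exit (inj₂ (inj₁ c)) (inj₁ d) = r12 T c d
  exit (inj₁ (inj₁ _)) _ = ⊥
  exit (inj₁ (inj₂ _)) (inj₁ _) = ⊥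
  exit (inj₂ (inj₂ _)) _ = ⊥
  exit (inj₂ (inj₁ _)) (inj₂ _) = ⊥

  module R[TS] = CompositeGraph R (T ∘I S)
  module ST = CompositeGraph S T
  module ElimC = Elimination direct entry loop exit

  module [SR]T = CompositeGraph (S ∘I R) T
  module RS = CompositeGraph R S
  -- Elimination removes the second block of hidden nodes, so swap them first.
  module ElimB = Elimination direct (λ i h → entry i (swap h)) (λ h h′ → loop (swap h) (swap h′))
                             (λ h o → exit (swap h) o)

  -- Pointwise, each component of the outer composite graph is either given by
  -- toRel-∘I of the inner composite, or has no entry or no exit edges.
  direct-R[TS] : R[TS].direct ≐ ElimC.direct′
  direct-R[TS] (inj₁ a) (inj₂ a′) = ⇔-sym (Flow-no-entry λ _ ())
  direct-R[TS] (inj₂ d′) (inj₁ d) = ⇔-trans (ST.toRel-∘I (inj₂ d′) (inj₁ d))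
    (Flow-pointwise ⇔-refl (λ { (inj₁ _) → ⇔-refl ; (inj₂ _) → ⇔-refl })
                           (λ { (inj₁ _) → ⇔-refl ; (inj₂ _) → ⇔-refl }))
  direct-R[TS] (inj₁ a) (inj₁ d) = ⇔-sym (Flow-no-entry λ _ ())
  direct-R[TS] (inj₂ d′) (inj₂ a′) = ⇔-sym (Flow-no-exit λ { (inj₁ _) () ; (inj₂ _) () })

  entry-R[TS] : R[TS].entry ≐ ElimC.entry′
  entry-R[TS] (inj₁ a) (inj₁ b) = ⇔-sym (Flow-no-entry λ _ ())
  entry-R[TS] (inj₁ a) (inj₂ b′) = ⇔-sym (Flow-no-entry λ _ ())
  entry-R[TS] (inj₂ d′) (inj₂ b′) = ⇔-trans (ST.toRel-∘I (inj₂ d′) (inj₂ b′))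
    (Flow-pointwise ⇔-refl (λ { (inj₁ _) → ⇔-refl ; (inj₂ _) → ⇔-refl })
                           (λ { (inj₁ _) → ⇔-refl ; (inj₂ _) → ⇔-refl }))
  entry-R[TS] (inj₂ d′) (inj₁ b) = ⇔-sym (Flow-no-exit λ { (inj₁ _) () ; (inj₂ _) () })

  loop-R[TS] : R[TS].loop ≐ ElimC.loop′
  loop-R[TS] (inj₁ b) (inj₂ b′) = ⇔-trans (ST.toRel-∘I (inj₁ b) (inj₂ b′))
    (Flow-pointwise ⇔-refl (λ { (inj₁ _) → ⇔-refl ; (inj₂ _) → ⇔-refl })
                           (λ { (inj₁ _) → ⇔-refl ; (inj₂ _) → ⇔-refl }))
  loop-R[TS] (inj₂ b′) (inj₁ b) = ⇔-sym (Flow-no-entry λ { (inj₁ _) () ; (inj₂ _) () })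
  loop-R[TS] (inj₁ b) (inj₁ b₁) = ⇔-sym (Flow-no-exit λ { (inj₁ _) () ; (inj₂ _) () })
  loop-R[TS] (inj₂ b′) (inj₂ b₁′) = ⇔-sym (Flow-no-entry λ { (inj₁ _) () ; (inj₂ _) () })

  exit-R[TS] : R[TS].exit ≐ ElimC.exit′
  exit-R[TS] (inj₁ b) (inj₁ d) = ⇔-trans (ST.toRel-∘I (inj₁ b) (inj₁ d))
    (Flow-pointwise ⇔-refl (λ { (inj₁ _) → ⇔-refl ; (inj₂ _) → ⇔-refl })
                           (λ { (inj₁ _) → ⇔-refl ; (inj₂ _) → ⇔-refl }))
  exit-R[TS] (inj₂ b′) (inj₂ a′) = ⇔-sym (Flow-no-entry λ { (inj₁ _) () ; (inj₂ _) () })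
  exit-R[TS] (inj₁ b) (inj₂ a′) = ⇔-sym (Flow-no-exit λ { (inj₁ _) () ; (inj₂ _) () })
  exit-R[TS] (inj₂ b′) (inj₁ d) = ⇔-sym (Flow-no-entry λ { (inj₁ _) () ; (inj₂ _) () })

  direct-[SR]T : [SR]T.direct ≐ ElimB.direct′
  direct-[SR]T (inj₁ a) (inj₂ a′) = ⇔-trans (RS.toRel-∘I (inj₁ a) (inj₂ a′))
    (Flow-pointwise ⇔-refl (λ { (inj₁ _) → ⇔-refl ; (inj₂ _) → ⇔-refl })
                           (λ { (inj₁ _) → ⇔-refl ; (inj₂ _) → ⇔-refl }))
  direct-[SR]T (inj₂ d′) (inj₁ d) = ⇔-sym (Flow-no-entry λ { (inj₁ _) () ; (inj₂ _) () })
  direct-[SR]T (inj₁ a) (inj₁ d) = ⇔-sym (Flow-no-exit λ { (inj₁ _) () ; (inj₂ _) () })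
  direct-[SR]T (inj₂ d′) (inj₂ a′) = ⇔-sym (Flow-no-entry λ { (inj₁ _) () ; (inj₂ _) () })

  entry-[SR]T : [SR]T.entry ≐ ElimB.entry′
  entry-[SR]T (inj₁ a) (inj₁ c) = ⇔-trans (RS.toRel-∘I (inj₁ a) (inj₁ c))
    (Flow-pointwise ⇔-refl (λ { (inj₁ _) → ⇔-refl ; (inj₂ _) → ⇔-refl })
                           (λ { (inj₁ _) → ⇔-refl ; (inj₂ _) → ⇔-refl }))
  entry-[SR]T (inj₁ a) (inj₂ c′) = ⇔-sym (Flow-no-exit λ { (inj₁ _) () ; (inj₂ _) () })
  entry-[SR]T (inj₂ d′) (inj₂ c′) = ⇔-sym (Flow-no-entry λ { (inj₁ _) () ; (inj₂ _) () })
  entry-[SR]T (inj₂ d′) (inj₁ c) = ⇔-sym (Flow-no-entry λ { (inj₁ _) () ; (inj₂ _) () })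

  loop-[SR]T : [SR]T.loop ≐ ElimB.loop′
  loop-[SR]T (inj₂ c′) (inj₁ c) = ⇔-trans (RS.toRel-∘I (inj₂ c′) (inj₁ c))
    (Flow-pointwise ⇔-refl (λ { (inj₁ _) → ⇔-refl ; (inj₂ _) → ⇔-refl })
                           (λ { (inj₁ _) → ⇔-refl ; (inj₂ _) → ⇔-refl }))
  loop-[SR]T (inj₁ c) (inj₂ c′) = ⇔-sym (Flow-no-entry λ { (inj₁ _) () ; (inj₂ _) () })
  loop-[SR]T (inj₁ c) (inj₁ c₁) = ⇔-sym (Flow-no-entry λ { (inj₁ _) () ; (inj₂ _) () })
  loop-[SR]T (inj₂ c′) (inj₂ c₁′) = ⇔-sym (Flow-no-exit λ { (inj₁ _) () ; (inj₂ _) () })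

  exit-[SR]T : [SR]T.exit ≐ ElimB.exit′
  exit-[SR]T (inj₂ c′) (inj₂ a′) = ⇔-trans (RS.toRel-∘I (inj₂ c′) (inj₂ a′))
    (Flow-pointwise ⇔-refl (λ { (inj₁ _) → ⇔-refl ; (inj₂ _) → ⇔-refl })
                           (λ { (inj₁ _) → ⇔-refl ; (inj₂ _) → ⇔-refl }))
  exit-[SR]T (inj₁ c) (inj₁ d) = ⇔-sym (Flow-no-entry λ { (inj₁ _) () ; (inj₂ _) () })
  exit-[SR]T (inj₁ c) (inj₂ a′) = ⇔-sym (Flow-no-entry λ { (inj₁ _) () ; (inj₂ _) () })
  exit-[SR]T (inj₂ c′) (inj₁ d) = ⇔-sym (Flow-no-exit λ { (inj₁ _) () ; (inj₂ _) () })

  [TS]R-flow : toRel ((T ∘I S) ∘I R) ≐ Flow direct entry loop exit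
  [TS]R-flow = ≐-trans (R[TS].toRel-∘I)
    (≐-trans (Flow-cong direct-R[TS] entry-R[TS] loop-R[TS] exit-R[TS]) (≐-sym ElimC.Flow-eliminate))

  T[SR]-flow : toRel (T ∘I (S ∘I R)) ≐ Flow direct entry loop exit
  T[SR]-flow = ≐-trans ([SR]T.toRel-∘I)
    (≐-trans (Flow-cong direct-[SR]T entry-[SR]T loop-[SR]T exit-[SR]T)
    (≐-trans (≐-sym ElimB.Flow-eliminate) (≐-sym (Flow-reindex swap-↔ direct entry loop exit))))

∘I-assoc : {A B C D : IntObj} (R : IntHom A B) (S : IntHom B C) (T : IntHom C D) →
           ((T ∘I S) ∘I R) ≈I (T ∘I (S ∘I R))
∘I-assoc R S T = toRel-≐⇒≈I (≐-trans [TS]R-flow (≐-sym T[SR]-flow))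
  where open Associativity R S T

-- The r11 and r22 of fromFuns are empty, so the feedback loop of these
-- composites has no steps.
fromFuns-∘I : {A B C : IntObj} (φ : pos B → pos C) (ψ : neg C → neg B) (R : IntHom A B) →
              (fromFuns {B} {C} φ ψ ∘I R) ≈I
              mkHom (graph φ ∙ r12 R) (r11 R) (r21 R ∙ graph ψ) (graph φ ∙ r22 R ∙ graph ψ)
fromFuns-∘I φ ψ R =
    (λ _ _ → (λ { (b , (_ , ρ , ε) , eq) → b , ρ , eq
                ; (_ , (_ , _ , ((_ , () , _) ◅ _)) , _) })
           , (λ (b , ρ , eq) → b , (b , ρ , ε) , eq))
  , (λ _ _ → (λ { (inj₁ ρ) → ρ ; (inj₂ (_ , (_ , _ , ()) , _)) }) , inj₁)
  , (λ _ _ → (λ { (b′ , (_ , eq , ε) , ρ) → b′ , eq , ρ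
                ; (_ , (_ , _ , ((_ , _ , ()) ◅ _)) , _) })
           , (λ (b′ , eq , ρ) → b′ , (b′ , eq , ε) , ρ))
  , (λ _ _ → (λ { (inj₁ ())
                ; (inj₂ (b , (b′ , (_ , eq , ε) , ρ) , eq′)) → b , (b′ , eq , ρ) , eq′
                ; (inj₂ (_ , (_ , (_ , _ , ((_ , _ , ()) ◅ _)) , _) , _)) })
           , (λ (b , (b′ , eq , ρ) , eq′) → inj₂ (b , (b′ , (b′ , eq , ε) , ρ) , eq′)))

∘I-fromFuns : {A B C : IntObj} (φ : pos A → pos B) (ψ : neg B → neg A) (R : IntHom B C) →
              (R ∘I fromFuns {A} {B} φ ψ) ≈I
              mkHom (r12 R ∙ graph φ) (graph ψ ∙ r11 R ∙ graph φ) (graph ψ ∙ r21 R) (r22 R)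
∘I-fromFuns φ ψ R =
    (λ _ _ → (λ { (_ , (b , eq , ε) , ρ) → b , eq , ρ
                ; (_ , (_ , _ , ((_ , _ , ()) ◅ _)) , _) })
           , (λ (b , eq , ρ) → b , (b , eq , ε) , ρ))
  , (λ _ _ → (λ { (inj₁ ())
                ; (inj₂ (b′ , (b , (_ , eq , ε) , ρ) , eq′)) → b′ , (b , eq , ρ) , eq′
                ; (inj₂ (_ , (_ , (_ , _ , ((_ , _ , ()) ◅ _)) , _) , _)) })
           , (λ (b′ , (b , eq , ρ) , eq′) → inj₂ (b′ , (b , (b , eq , ε) , ρ) , eq′)))
  , (λ _ _ → (λ { (b′ , (_ , ρ , ε) , eq) → b′ , ρ , eq
                ; (_ , (_ , _ , ((_ , () , _) ◅ _)) , _) })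
           , (λ (b′ , ρ , eq) → b′ , (b′ , ρ , ε) , eq))
  , (λ _ _ → (λ { (inj₁ ρ) → ρ ; (inj₂ (_ , (_ , _ , ()) , _)) }) , inj₁)

∘I-identityˡ : {A B : IntObj} (f : IntHom A B) → (idInt B ∘I f) ≈I f
∘I-identityˡ f = ≈I-trans (fromFuns-∘I id id f)
  (∙-identityˡ , ≐-refl , ∙-identityʳ , ≐-trans ∙-identityˡ ∙-identityʳ)

∘I-identityʳ : {A B : IntObj} (f : IntHom A B) → (f ∘I idInt A) ≈I f
∘I-identityʳ f = ≈I-trans (∘I-fromFuns id id f)
  (∙-identityʳ , ≐-trans ∙-identityˡ ∙-identityʳ , ∙-identityˡ , ≐-refl)

⊗IH-∘I : {A B C D E F : IntObj} (f : IntHom A B) (g : IntHom B C) (h : IntHom D E) (k : IntHom E F) →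
         ((g ∘I f) ⊗IH (k ∘I h)) ≈I ((g ⊗IH k) ∘I (f ⊗IH h))
⊗IH-∘I f g h k = ≈I-sym (⊕-∙*∙ , ⊕-∪-∙ , ⊕-∙*∙ , ⊕-∪-∙)

fromFuns-∘ : {A B C : IntObj}
             (f : pos A → pos B) (f′ : neg B → neg A) (g : pos B → pos C) (g′ : neg C → neg B) →
             (fromFuns {B} {C} g g′ ∘I fromFuns {A} {B} f f′) ≈I fromFuns {A} {C} (g ∘ f) (f′ ∘ g′)
fromFuns-∘ f f′ g g′ = ≈I-trans (fromFuns-∘I g g′ (fromFuns f f′))
  (graph-∙ f g , ≐-refl , graph-∙ g′ f′ , λ _ _ → (λ { (_ , (_ , _ , ()) , _) }) , λ ())

fromFuns-cong : {A B : IntObj} {f g : pos A → pos B} {f′ g′ : neg B → neg A} →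
                (∀ a → f a ≡ g a) → (∀ b′ → f′ b′ ≡ g′ b′) → fromFuns {A} {B} f f′ ≈I fromFuns g g′
fromFuns-cong f≗g f′≗g′ = graph-cong f≗g , ≐-refl , graph-cong f′≗g′ , ≐-refl

fromFuns-⊗ : {A B C D : IntObj}
             (f : pos A → pos B) (f′ : neg B → neg A) (g : pos C → pos D) (g′ : neg D → neg C) →
             (fromFuns {A} {B} f f′ ⊗IH fromFuns {C} {D} g g′)
             ≈I fromFuns {A ⊗IO C} {B ⊗IO D} (map f g) (map f′ g′)
fromFuns-⊗ f f′ g g′ = graph-⊕ f g , ∅-⊕ , graph-⊕ f′ g′ , ∅-⊕

⊗IH-identity : (A C : IntObj) → (idInt A ⊗IH idInt C) ≈I idInt (A ⊗IO C)
⊗IH-identity A C = ≈I-trans (fromFuns-⊗ id id id id) (fromFuns-cong map-id map-id)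

-- Structural isomorphisms

assocʳ-assocˡ : {X Y Z : Set} (u : X ⊎ (Y ⊎ Z)) → assocʳ (assocˡ u) ≡ u
assocʳ-assocˡ (inj₁ _) = refl
assocʳ-assocˡ (inj₂ (inj₁ _)) = refl
assocʳ-assocˡ (inj₂ (inj₂ _)) = refl

assocˡ-assocʳ : {X Y Z : Set} (u : (X ⊎ Y) ⊎ Z) → assocˡ (assocʳ u) ≡ u
assocˡ-assocʳ (inj₁ (inj₁ _)) = refl
assocˡ-assocʳ (inj₁ (inj₂ _)) = refl
assocˡ-assocʳ (inj₂ _) = refl

⊎-assoc-↔ : {X Y Z : Set} → ((X ⊎ Y) ⊎ Z) ↔ (X ⊎ (Y ⊎ Z))
⊎-assoc-↔ = mk↔ₛ′ assocʳ assocˡ assocʳ-assocˡ assocˡ-assocʳ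

⊥⊎-↔ : {X : Set} → (⊥ ⊎ X) ↔ X
⊥⊎-↔ = mk↔ₛ′ dropˡ inj₂ (λ _ → refl) λ { (inj₂ _) → refl }

⊎⊥-↔ : {X : Set} → (X ⊎ ⊥) ↔ X
⊎⊥-↔ = mk↔ₛ′ dropʳ inj₁ (λ _ → refl) λ { (inj₁ _) → refl }

IntIso : IntObj → IntObj → Set
IntIso A B = (pos A ↔ pos B) × (neg A ↔ neg B)

IntIso-sym : {A B : IntObj} → IntIso A B → IntIso B A
IntIso-sym (φ⁺ , φ⁻) = ↔-sym φ⁺ , ↔-sym φ⁻

fromIso : {A B : IntObj} → IntIso A B → IntHom A B
fromIso (φ⁺ , φ⁻) = fromFuns (to φ⁺) (from φ⁻)

α-iso : (A B C : IntObj) → IntIso ((A ⊗IO B) ⊗IO C) (A ⊗IO (B ⊗IO C))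
α-iso A B C = ⊎-assoc-↔ , ⊎-assoc-↔

λ-iso : (A : IntObj) → IntIso (IInt ⊗IO A) A
λ-iso A = ⊥⊎-↔ , ⊥⊎-↔

ρ-iso : (A : IntObj) → IntIso (A ⊗IO IInt) A
ρ-iso A = ⊎⊥-↔ , ⊎⊥-↔

fromIso-inverse : {A B : IntObj} (φ : IntIso A B) → (fromIso (IntIso-sym φ) ∘I fromIso φ) ≈I idInt A
fromIso-inverse (φ⁺ , φ⁻) = ≈I-trans (fromFuns-∘ (to φ⁺) (from φ⁻) (from φ⁺) (to φ⁻))
  (fromFuns-cong (strictlyInverseʳ φ⁺) (strictlyInverseʳ φ⁻))

Conjugate : {A B C D : IntObj} → IntIso A C → IntIso B D → IntHom A B → IntHom C D → Set
Conjugate (φ⁺ , φ⁻) (ψ⁺ , ψ⁻) L M =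
    (∀ a b → r12 L a b ⇔ r12 M (to φ⁺ a) (to ψ⁺ b))
  × (∀ a a′ → r11 L a a′ ⇔ r11 M (to φ⁺ a) (to φ⁻ a′))
  × (∀ b′ a′ → r21 L b′ a′ ⇔ r21 M (to ψ⁻ b′) (to φ⁻ a′))
  × (∀ b′ b → r22 L b′ b ⇔ r22 M (to ψ⁻ b′) (to ψ⁺ b))

fromIso-natural : {A B C D : IntObj} (φ : IntIso A C) (ψ : IntIso B D) (L : IntHom A B) (M : IntHom C D) →
                  Conjugate φ ψ L M → (fromIso ψ ∘I L) ≈I (M ∘I fromIso φ)
fromIso-natural (φ⁺ , φ⁻) (ψ⁺ , ψ⁻) L M (k₁₂ , k₁₁ , k₂₁ , k₂₂) =
  ≈I-trans (fromFuns-∘I (to ψ⁺) (from ψ⁻) L)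
    (≈I-trans (c₁₂ , c₁₁ , c₂₁ , c₂₂) (≈I-sym (∘I-fromFuns (to φ⁺) (from φ⁻) M)))
  where
  c₁₂ : (graph (to ψ⁺) ∙ r12 L) ≐ (r12 M ∙ graph (to φ⁺))
  c₁₂ a d = ⇔-trans (image-↔ ψ⁺ (r12 L a) d)
    (⇔-trans (k₁₂ a (from ψ⁺ d))
    (⇔-trans (subst₂-⇔ (r12 M) refl (strictlyInverseˡ ψ⁺ d))
             (⇔-sym (preimage-graph (to φ⁺) (λ c → r12 M c d) a))))
  c₁₁ : r11 L ≐ (graph (from φ⁻) ∙ r11 M ∙ graph (to φ⁺))
  c₁₁ a a′ = ⇔-trans (k₁₁ a a′)
    (⇔-sym (⇔-trans (image-↔ (↔-sym φ⁻) (λ c′ → (r11 M ∙ graph (to φ⁺)) a c′) a′)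
                    (preimage-graph (to φ⁺) (λ c → r11 M c (to φ⁻ a′)) a)))
  c₂₁ : (r21 L ∙ graph (from ψ⁻)) ≐ (graph (from φ⁻) ∙ r21 M)
  c₂₁ d′ a′ = ⇔-trans (preimage-graph (from ψ⁻) (λ b′ → r21 L b′ a′) d′)
    (⇔-trans (k₂₁ (from ψ⁻ d′) a′)
    (⇔-trans (subst₂-⇔ (r21 M) (strictlyInverseˡ ψ⁻ d′) refl)
             (⇔-sym (image-↔ (↔-sym φ⁻) (r21 M d′) a′))))
  c₂₂ : (graph (to ψ⁺) ∙ r22 L ∙ graph (from ψ⁻)) ≐ r22 M
  c₂₂ d′ d = ⇔-trans (image-↔ ψ⁺ (λ b → (r22 L ∙ graph (from ψ⁻)) d′ b) d)
    (⇔-trans (preimage-graph (from ψ⁻) (λ b′ → r22 L b′ (from ψ⁺ d)) d′)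
    (⇔-trans (k₂₂ (from ψ⁻ d′) (from ψ⁺ d))
             (subst₂-⇔ (r22 M) (strictlyInverseˡ ψ⁻ d′) (strictlyInverseˡ ψ⁺ d))))

⊕-assoc-⇔ : {X X′ Y Y′ Z Z′ : Set} (P : Rel X X′) (Q : Rel Y Y′) (W : Rel Z Z′) →
            ∀ u v → ((P ⊕ Q) ⊕ W) u v ⇔ (P ⊕ (Q ⊕ W)) (assocʳ u) (assocʳ v)
⊕-assoc-⇔ P Q W (inj₁ (inj₁ _)) (inj₁ (inj₁ _)) = ⇔-refl
⊕-assoc-⇔ P Q W (inj₁ (inj₁ _)) (inj₁ (inj₂ _)) = ⇔-refl
⊕-assoc-⇔ P Q W (inj₁ (inj₁ _)) (inj₂ _) = ⇔-refl
⊕-assoc-⇔ P Q W (inj₁ (inj₂ _)) (inj₁ (inj₁ _)) = ⇔-refl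
⊕-assoc-⇔ P Q W (inj₁ (inj₂ _)) (inj₁ (inj₂ _)) = ⇔-refl
⊕-assoc-⇔ P Q W (inj₁ (inj₂ _)) (inj₂ _) = ⇔-refl
⊕-assoc-⇔ P Q W (inj₂ _) (inj₁ (inj₁ _)) = ⇔-refl
⊕-assoc-⇔ P Q W (inj₂ _) (inj₁ (inj₂ _)) = ⇔-refl
⊕-assoc-⇔ P Q W (inj₂ _) (inj₂ _) = ⇔-refl

⊥⊕-⇔ : {X X′ : Set} (E : Rel ⊥ ⊥) (P : Rel X X′) → ∀ u v → (E ⊕ P) u v ⇔ P (dropˡ u) (dropˡ v)
⊥⊕-⇔ E P (inj₂ _) (inj₂ _) = ⇔-refl

⊕⊥-⇔ : {X X′ : Set} (E : Rel ⊥ ⊥) (P : Rel X X′) → ∀ u v → (P ⊕ E) u v ⇔ P (dropʳ u) (dropʳ v)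
⊕⊥-⇔ E P (inj₁ _) (inj₁ _) = ⇔-refl

α-natural : {A A′ B B′ C C′ : IntObj} (f : IntHom A A′) (g : IntHom B B′) (h : IntHom C C′) →
            (αInt A′ B′ C′ ∘I ((f ⊗IH g) ⊗IH h)) ≈I ((f ⊗IH (g ⊗IH h)) ∘I αInt A B C)
α-natural {A} {A′} {B} {B′} {C} {C′} f g h =
  fromIso-natural (α-iso A B C) (α-iso A′ B′ C′) ((f ⊗IH g) ⊗IH h) (f ⊗IH (g ⊗IH h))
    ( ⊕-assoc-⇔ (r12 f) (r12 g) (r12 h) , ⊕-assoc-⇔ (r11 f) (r11 g) (r11 h)
    , ⊕-assoc-⇔ (r21 f) (r21 g) (r21 h) , ⊕-assoc-⇔ (r22 f) (r22 g) (r22 h))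

λ-natural : {A B : IntObj} (f : IntHom A B) → (λInt B ∘I (idInt IInt ⊗IH f)) ≈I (f ∘I λInt A)
λ-natural {A} {B} f = fromIso-natural (λ-iso A) (λ-iso B) (idInt IInt ⊗IH f) f
  (⊥⊕-⇔ IdR (r12 f) , ⊥⊕-⇔ ∅R (r11 f) , ⊥⊕-⇔ IdR (r21 f) , ⊥⊕-⇔ ∅R (r22 f))

ρ-natural : {A B : IntObj} (f : IntHom A B) → (ρInt B ∘I (f ⊗IH idInt IInt)) ≈I (f ∘I ρInt A)
ρ-natural {A} {B} f = fromIso-natural (ρ-iso A) (ρ-iso B) (f ⊗IH idInt IInt) f
  (⊕⊥-⇔ IdR (r12 f) , ⊕⊥-⇔ ∅R (r11 f) , ⊕⊥-⇔ IdR (r21 f) , ⊕⊥-⇔ ∅R (r22 f))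

pentagon : (A B C D : IntObj) →
           ((idInt A ⊗IH αInt B C D) ∘I (αInt A (B ⊗IO C) D ∘I (αInt A B C ⊗IH idInt D)))
           ≈I (αInt A B (C ⊗IO D) ∘I αInt (A ⊗IO B) C D)
pentagon A B C D =
  ≈I-trans (∘I-cong (fromFuns-⊗ {A} {A} {(B ⊗IO C) ⊗IO D} id id assocʳ assocˡ)
                    (∘I-cong ≈I-refl (fromFuns-⊗ {(A ⊗IO B) ⊗IO C} {_} {D} assocʳ assocˡ id id)))
  (≈I-trans (∘I-cong ≈I-refl (fromFuns-∘ (map assocʳ id) (map assocˡ id) assocʳ assocˡ))
  (≈I-trans (fromFuns-∘ _ _ (map id assocʳ) (map id assocˡ))
  (≈I-trans (fromFuns-cong pentagon⁺ pentagon⁻)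
  (≈I-sym (fromFuns-∘ assocʳ assocˡ assocʳ assocˡ)))))
  where
  pentagon⁺ : {W X Y Z : Set} (u : ((W ⊎ X) ⊎ Y) ⊎ Z) →
              map id assocʳ (assocʳ (map assocʳ id u)) ≡ assocʳ (assocʳ u)
  pentagon⁺ (inj₁ (inj₁ (inj₁ _))) = refl
  pentagon⁺ (inj₁ (inj₁ (inj₂ _))) = refl
  pentagon⁺ (inj₁ (inj₂ _)) = refl
  pentagon⁺ (inj₂ _) = refl
  pentagon⁻ : {W X Y Z : Set} (u : W ⊎ (X ⊎ (Y ⊎ Z))) →
              map assocˡ id (assocˡ (map id assocˡ u)) ≡ assocˡ (assocˡ u)
  pentagon⁻ (inj₁ _) = refl
  pentagon⁻ (inj₂ (inj₁ _)) = refl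
  pentagon⁻ (inj₂ (inj₂ (inj₁ _))) = refl
  pentagon⁻ (inj₂ (inj₂ (inj₂ _))) = refl

triangle : (A B : IntObj) → ((idInt A ⊗IH λInt B) ∘I αInt A IInt B) ≈I (ρInt A ⊗IH idInt B)
triangle A B =
  ≈I-trans (∘I-cong (fromFuns-⊗ {A} {A} {IInt ⊗IO B} id id dropˡ inj₂) ≈I-refl)
  (≈I-trans (fromFuns-∘ assocʳ assocˡ (map id dropˡ) (map id inj₂))
  (≈I-trans (fromFuns-cong triangle⁺ triangle⁻)
  (≈I-sym (fromFuns-⊗ {A ⊗IO IInt} {A} {B} dropʳ inj₁ id id))))
  where
  triangle⁺ : {X Y : Set} (u : (X ⊎ ⊥) ⊎ Y) → map id dropˡ (assocʳ u) ≡ map dropʳ id u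
  triangle⁺ (inj₁ (inj₁ _)) = refl
  triangle⁺ (inj₂ _) = refl
  triangle⁻ : {X Y : Set} (u : X ⊎ Y) → assocˡ (map id (inj₂ {A = ⊥}) u) ≡ map inj₁ id u
  triangle⁻ (inj₁ _) = refl
  triangle⁻ (inj₂ _) = refl

-- Positive maps

≗S-trans : {A : Set} {X Y Z : Subset A} → X ≗S Y → Y ≗S Z → X ≗S Z
≗S-trans X≗Y Y≗Z a = ⇔-trans (X≗Y a) (Y≗Z a)

≗S-⊎ : {A B : Set} {X X′ : Subset A} {Y Y′ : Subset B} → X ≗S X′ → Y ≗S Y′ → [ X , Y ] ≗S [ X′ , Y′ ]
≗S-⊎ X≗X′ Y≗Y′ (inj₁ a) = X≗X′ a
≗S-⊎ X≗X′ Y≗Y′ (inj₂ b) = Y≗Y′ b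

IsEmpty-⊎ : {A B : Set} {X : Subset A} {Y : Subset B} → IsEmpty X → IsEmpty Y → IsEmpty [ X , Y ]
IsEmpty-⊎ X-empty Y-empty (inj₁ a) = X-empty a
IsEmpty-⊎ X-empty Y-empty (inj₂ b) = Y-empty b

≗S-IsEmpty : {A : Set} {X Y : Subset A} → X ≗S Y → IsEmpty Y → IsEmpty X
≗S-IsEmpty X≗Y Y-empty a x = Y-empty a (proj₁ (X≗Y a) x)

module _ {A B C D : Set} (R : Rel A B) (S : Rel C D) where

  preimg-⊕ : (M : Subset B) (N : Subset D) → preimg [ M , N ] (R ⊕ S) ≗S [ preimg M R , preimg N S ]
  preimg-⊕ M N (inj₁ a) = (λ { (inj₁ b , m , ρ) → b , m , ρ }) , (λ (b , m , ρ) → inj₁ b , m , ρ)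
  preimg-⊕ M N (inj₂ c) = (λ { (inj₂ d , n , σ) → d , n , σ }) , (λ (d , n , σ) → inj₂ d , n , σ)

  img-⊕ : (M : Subset A) (N : Subset C) → img (R ⊕ S) [ M , N ] ≗S [ img R M , img S N ]
  img-⊕ M N (inj₁ b) = (λ { (inj₁ a , m , ρ) → a , m , ρ }) , (λ (a , m , ρ) → inj₁ a , m , ρ)
  img-⊕ M N (inj₂ d) = (λ { (inj₂ c , n , σ) → c , n , σ }) , (λ (c , n , σ) → inj₂ c , n , σ)

Preserves : {X Y : Set} → X ↔ Y → Subset X → Subset Y → Set
Preserves φ M N = ∀ x → N (to φ x) ⇔ M x

Preserves-sym : {X Y : Set} (φ : X ↔ Y) {M : Subset X} {N : Subset Y} →
                Preserves φ M N → Preserves (↔-sym φ) N M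
Preserves-sym φ {N = N} φ-pres y = ⇔-trans (⇔-sym (φ-pres (from φ y))) (subst-⇔ N (strictlyInverseˡ φ y))

PosIso : PosObj → PosObj → Set
PosIso A B = Σ (IntIso (under A) (under B)) λ (φ⁺ , φ⁻) →
               Preserves φ⁺ (mp⁺ A) (mp⁺ B) × Preserves φ⁻ (mp⁻ A) (mp⁻ B)

PosIso-sym : {A B : PosObj} → PosIso A B → PosIso B A
PosIso-sym ((φ⁺ , φ⁻) , φ⁺-pres , φ⁻-pres) =
  IntIso-sym (φ⁺ , φ⁻) , Preserves-sym φ⁺ φ⁺-pres , Preserves-sym φ⁻ φ⁻-pres

fromIso-positive : {A B : PosObj} (φ : PosIso A B) → IsPositive A B (fromIso (proj₁ φ))
fromIso-positive {A} {B} ((φ⁺ , φ⁻) , φ⁺-pres , φ⁻-pres) = record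
  { cond1 = λ a → (λ { (_ , m , refl) → proj₁ (φ⁺-pres a) m }) , (λ m → to φ⁺ a , proj₂ (φ⁺-pres a) m , refl)
  ; cond2 = λ a′ → ⇔-trans (image-↔ (↔-sym φ⁻) (mp⁻ B) a′) (φ⁻-pres a′)
  ; cond3a = λ { _ (_ , _ , ()) }
  ; cond3b = λ { _ (_ , _ , ()) } }

id-positive : (A : PosObj) → IsPositive A A (idInt (under A))
id-positive A = fromIso-positive ((↔-id _ , ↔-id _) , (λ _ → ⇔-refl) , (λ _ → ⇔-refl))

⊗IH-positive : {A B C D : PosObj} (R : IntHom (under A) (under B)) (S : IntHom (under C) (under D)) →
               IsPositive A B R → IsPositive C D S → IsPositive (A ⊗PO C) (B ⊗PO D) (R ⊗IH S)
⊗IH-positive {B = B} {D = D} R S r s = record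
  { cond1 = ≗S-trans (preimg-⊕ (r12 R) (r12 S) (mp⁺ B) (mp⁺ D)) (≗S-⊎ (cond1 r) (cond1 s))
  ; cond2 = ≗S-trans (img-⊕ (r21 R) (r21 S) (mp⁻ B) (mp⁻ D)) (≗S-⊎ (cond2 r) (cond2 s))
  ; cond3a = ≗S-IsEmpty (preimg-⊕ (r22 R) (r22 S) (mp⁺ B) (mp⁺ D)) (IsEmpty-⊎ (cond3a r) (cond3a s))
  ; cond3b = ≗S-IsEmpty (img-⊕ (r22 R) (r22 S) (mp⁻ B) (mp⁻ D)) (IsEmpty-⊎ (cond3b r) (cond3b s)) }
  where open IsPositive

-- Condition (3) on R makes the feedback loop of S ∘I R invisible from the
-- marked points of B: a loop step never ends in mp⁺ B nor starts in mp⁻ B.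
∘I-positive : {A B C : PosObj} (S : IntHom (under B) (under C)) (R : IntHom (under A) (under B)) →
              IsPositive B C S → IsPositive A B R → IsPositive A C (S ∘I R)
∘I-positive {A} {B} {C} S R s r = record
  { cond1 = λ a →
      (λ (c , mc , (b , (b₀ , ρ , w) , σ)) →
         let mb = proj₁ (s.cond1 b) (c , mc , σ)
         in proj₁ (r.cond1 a) (b₀ , subst (mp⁺ B) (sym (Star-into-unreachable loop-avoids-mp⁺ w mb)) mb , ρ))
    , (λ ma → let (b , mb , ρ) = proj₂ (r.cond1 a) ma
                  (c , mc , σ) = proj₂ (s.cond1 b) mb
              in c , mc , (b , (b , ρ , ε) , σ))
  ; cond2 = λ a′ →
      (λ (c′ , mc′ , (b′ , (b₀′ , σ , w) , ρ)) →
         let mb₀′ = proj₁ (s.cond2 b₀′) (c′ , mc′ , σ)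
         in proj₁ (r.cond2 a′) (b′ , subst (mp⁻ B) (Star-from-inescapable loop-avoids-mp⁻ mb₀′ w) mb₀′ , ρ))
    , (λ ma′ → let (b′ , mb′ , ρ) = proj₂ (r.cond2 a′) ma′
                   (c′ , mc′ , σ) = proj₂ (s.cond2 b′) mb′
               in c′ , mc′ , (b′ , (b′ , σ , ε) , ρ))
  ; cond3a = λ { c′ (c , mc , inj₁ σ) → s.cond3a c′ (c , mc , σ)
               ; _ (c , mc , inj₂ (b , (b′ , _ , ρ) , σ)) → r.cond3a b′ (b , proj₁ (s.cond1 b) (c , mc , σ) , ρ) }
  ; cond3b = λ { c (c′ , mc′ , inj₁ σ) → s.cond3b c (c′ , mc′ , σ)
               ; _ (c′ , mc′ , inj₂ (b , (b′ , (b₀′ , σ , w) , ρ) , _)) →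
                   let mb₀′ = proj₁ (s.cond2 b₀′) (c′ , mc′ , σ)
                   in r.cond3b b (b′ , subst (mp⁻ B) (Star-from-inescapable loop-avoids-mp⁻ mb₀′ w) mb₀′ , ρ) } }
  where
  module s = IsPositive s
  module r = IsPositive r
  loop-avoids-mp⁺ : ∀ {b b₁} → (r22 R ∙ r11 S) b b₁ → ¬ mp⁺ B b₁
  loop-avoids-mp⁺ {b₁ = b₁} (b′ , _ , ρ) m = r.cond3a b′ (b₁ , m , ρ)
  loop-avoids-mp⁻ : ∀ {b′ b₁′} → (r11 S ∙ r22 R) b′ b₁′ → ¬ mp⁻ B b′
  loop-avoids-mp⁻ {b′ = b′} (b , ρ , _) m = r.cond3b b (b′ , m , ρ)

⊎-assoc-preserves : {X Y Z : Set} (M : Subset X) (N : Subset Y) (K : Subset Z) →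
                    Preserves ⊎-assoc-↔ [ [ M , N ] , K ] [ M , [ N , K ] ]
⊎-assoc-preserves M N K (inj₁ (inj₁ _)) = ⇔-refl
⊎-assoc-preserves M N K (inj₁ (inj₂ _)) = ⇔-refl
⊎-assoc-preserves M N K (inj₂ _) = ⇔-refl

⊥⊎-preserves : {X : Set} (M₀ : Subset ⊥) (M : Subset X) → Preserves ⊥⊎-↔ [ M₀ , M ] M
⊥⊎-preserves M₀ M (inj₂ _) = ⇔-refl

⊎⊥-preserves : {X : Set} (M₀ : Subset ⊥) (M : Subset X) → Preserves ⊎⊥-↔ [ M , M₀ ] M
⊎⊥-preserves M₀ M (inj₁ _) = ⇔-refl

α-posIso : (A B C : PosObj) → PosIso ((A ⊗PO B) ⊗PO C) (A ⊗PO (B ⊗PO C))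
α-posIso A B C = α-iso (under A) (under B) (under C)
               , ⊎-assoc-preserves (mp⁺ A) (mp⁺ B) (mp⁺ C) , ⊎-assoc-preserves (mp⁻ A) (mp⁻ B) (mp⁻ C)

λ-posIso : (A : PosObj) → PosIso (IPos ⊗PO A) A
λ-posIso A = λ-iso (under A) , ⊥⊎-preserves (mp⁺ IPos) (mp⁺ A) , ⊥⊎-preserves (mp⁻ IPos) (mp⁻ A)

ρ-posIso : (A : PosObj) → PosIso (A ⊗PO IPos) A
ρ-posIso A = ρ-iso (under A) , ⊎⊥-preserves (mp⁺ IPos) (mp⁺ A) , ⊎⊥-preserves (mp⁻ IPos) (mp⁻ A)

posClosure : PosClosure
posClosure = record
  { id-pos = id-positive
  ; ∘-pos = ∘I-positive
  ; ⊗-pos = ⊗IH-positive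
  ; α-pos = λ A B C → fromIso-positive (α-posIso A B C)
  ; α⁻¹-pos = λ A B C → fromIso-positive (PosIso-sym (α-posIso A B C))
  ; λ-pos = λ A → fromIso-positive (λ-posIso A)
  ; λ⁻¹-pos = λ A → fromIso-positive (PosIso-sym (λ-posIso A))
  ; ρ-pos = λ A → fromIso-positive (ρ-posIso A)
  ; ρ⁻¹-pos = λ A → fromIso-positive (PosIso-sym (ρ-posIso A))
  }

-- The Pos-level composite and tensor only compute on pairs, hence the patterns.
mainTheorem11 : Σ PosClosure (λ c → PosStructure.IsMonoidalPos c)
mainTheorem11 = posClosure , record
  { ≈-refl = ≈I-refl
  ; ≈-sym = ≈I-sym
  ; ≈-trans = ≈I-trans
  ; ∘-resp-≈ = λ { {f = _ , _} {_ , _} {_ , _} {_ , _} → ∘I-cong }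
  ; identityˡ = λ (f , _) → ∘I-identityˡ f
  ; identityʳ = λ (f , _) → ∘I-identityʳ f
  ; assoc = λ (f , _) (g , _) (h , _) → ∘I-assoc f g h
  ; ⊗-resp-≈ = λ { {f = _ , _} {_ , _} {_ , _} {_ , _} → ⊗IH-cong }
  ; ⊗-identity = λ A C → ⊗IH-identity (under A) (under C)
  ; ⊗-homomorphism = λ (f , _) (g , _) (h , _) (k , _) → ⊗IH-∘I f g h k
  ; α-isoˡ = λ A B C → fromIso-inverse (α-iso (under A) (under B) (under C))
  ; α-isoʳ = λ A B C → fromIso-inverse (IntIso-sym (α-iso (under A) (under B) (under C)))
  ; λ-isoˡ = λ A → fromIso-inverse (λ-iso (under A))
  ; λ-isoʳ = λ A → fromIso-inverse (IntIso-sym (λ-iso (under A)))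
  ; ρ-isoˡ = λ A → fromIso-inverse (ρ-iso (under A))
  ; ρ-isoʳ = λ A → fromIso-inverse (IntIso-sym (ρ-iso (under A)))
  ; α-natural = λ (f , _) (g , _) (h , _) → α-natural f g h
  ; λ-natural = λ (f , _) → λ-natural f
  ; ρ-natural = λ (f , _) → ρ-natural f
  ; pentagon = λ A B C D → pentagon (under A) (under B) (under C) (under D)
  ; triangle = λ A B → triangle (under A) (under B)
  }
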